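{- Let $n\ge 2$, let $T$ be a rooted binary phylogenetic tree on $n$ leaves, and let $\theta\neq\theta'$ be SNPR (prune-and-regraft) operations on $T$ with $\theta(T)=\theta'(T)=T'\neq T$. Then there exists an NNI operation $\sigma$ on $T$ with $\sigma(T)=T'$. Furthermore, every maximal set of pairwise redundant SNPR operations on $T$ yielding a tree different from $T$ has size exactly three.
   Context: A rooted binary phylogenetic tree on $n\ge2$ leaves is a directed tree with a root of in-degree 0 and out-degree 1, $n$ leaves of in-degree 1 and out-degree 0 bijectively labelled by a fixed set of taxa, and inner vertices of in-degree 1 and out-degree 2. Two trees are regarded as equal if there is a leaf-label-preserving isomorphism between them. An edge $(a,b)$ is a descendant of $(c,d)$ if $d=a$ or there is a directed path from $d$ to $a$. Pruning $e=(u,v)$ turns it into a half edge $(\cdot,v)$ and suppresses $u$ (replacing the path $p\to u\to c$ by an edge $(p,c)$); regrafting $(\cdot,v)$ to an edge $f$ subdivides $f$ with a new vertex $u'$ and adds $(u',v)$. An SNPR (prune-and-regraft) operation $(e,f)$, for an edge $e$ and an edge $f\neq e$ not a descendant of $e$, prunes $e$ and regrafts it to $f$. Two distinct operations are redundant if they yield the same tree. NNI operation on a tree: let $e=(u,v)$ be an inner edge (not incident to the root or a leaf), let $g$ be a child edge of $v$ and $f$ the sibling edge of $e$ (the other outgoing edge of $u$); the NNI operation $(f,e,g)$ prunes $g$ and regrafts it to $f$. -}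

module Defs where

open import Data.Nat using (ℕ; _≤_)
open import Data.Fin using (Fin)
open import Data.List using (List; []; _∷_; _++_; allFin; length)
open import Data.List.Relation.Binary.Permutation.Propositional using (_↭_)
open import Data.Product using (_×_; _,_)
open import Data.Unit using (⊤)
open import Data.Empty using (⊥)
open import Relation.Nullary using (¬_)
open import Relation.Binary.PropositionalEquality using (_≡_)

-- The root vertex ρ (in-degree 0,
-- out-degree 1) is implicit: the whole BT is the subtree below the root edge.
-- Children are ordered only in the representation; tree equality is _≅_ below.
data BT (A : Set) : Set where
  leaf : A → BT A
  node : BT A → BT A → BT A

leaves : ∀ {A} → BT A → List A
leaves (leaf x)   = x ∷ []
leaves (node a b) = leaves a ++ leaves b

IsPhylo : ∀ {n} → BT (Fin n) → Set
IsPhylo {n} t = leaves t ↭ allFin n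

-- Equality of phylogenetic trees = leaf-label-preserving isomorphism
-- (= equality up to swapping children of inner vertices).
data _≅_ {A : Set} : BT A → BT A → Set where
  leaf : ∀ {x} → leaf x ≅ leaf x
  node : ∀ {a b c d} → a ≅ c → b ≅ d → node a b ≅ node c d
  swap : ∀ {a b c d} → a ≅ d → b ≅ c → node a b ≅ node c d

-- Edges: every edge (u,v) is identified with the position of its head v,
-- given as a path of directions from the top vertex (child of the root ρ).
-- The empty path is the root edge (ρ, top).
data Dir : Set where
  L R : Dir

flip : Dir → Dir
flip L = R
flip R = L

Path : Set
Path = List Dir

data Valid {A : Set} : BT A → Path → Set where
  here : ∀ {t} → Valid t []
  goL  : ∀ {a b p} → Valid a p → Valid (node a b) (L ∷ p)
  goR  : ∀ {a b p} → Valid b p → Valid (node a b) (R ∷ p)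

-- prefix order on paths: p ≼ q iff the edge q is e or a descendant edge of e=p
data _≼_ : Path → Path → Set where
  nil  : ∀ {q} → [] ≼ q
  cons : ∀ {d p q} → p ≼ q → (d ∷ p) ≼ (d ∷ q)

-- subtree below an edge (junk on invalid paths)
sub : ∀ {A} → BT A → Path → BT A
sub t [] = t
sub (leaf x) (_ ∷ _) = leaf x
sub (node a b) (L ∷ p) = sub a p
sub (node a b) (R ∷ p) = sub b p

-- pruning edge e=(u,v): remove subtree at v and suppress u
pruneAt : ∀ {A} → BT A → Path → BT A
pruneAt (node a b) (L ∷ []) = b
pruneAt (node a b) (R ∷ []) = a
pruneAt (node a b) (L ∷ d ∷ p) = node (pruneAt a (d ∷ p)) b
pruneAt (node a b) (R ∷ d ∷ p) = node a (pruneAt b (d ∷ p))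
pruneAt t _ = t

-- position, in the pruned tree, of an edge f of T not below e
-- (the parent edge and the sibling edge of e both become the merged edge (p,c))
mapPos : Path → Path → Path
mapPos (L ∷ []) (R ∷ r) = r
mapPos (R ∷ []) (L ∷ r) = r
mapPos (_ ∷ _) [] = []
mapPos (L ∷ d ∷ p) (L ∷ r) = L ∷ mapPos (d ∷ p) r
mapPos (R ∷ d ∷ p) (R ∷ r) = R ∷ mapPos (d ∷ p) r
mapPos _ f = f

-- regrafting subtree x to edge at position f: subdivide it, hang x on new vertex
graft : ∀ {A} → BT A → Path → BT A → BT A
graft s [] x = node s x
graft (node a b) (L ∷ r) x = node (graft a r x) b
graft (node a b) (R ∷ r) x = node a (graft b r x)
graft s (_ ∷ _) x = node s x

Op : Set
Op = Path × Path

-- e is an edge other than the root edge (its tail must be suppressible),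
-- f is an edge, f ≠ e and f is not a descendant of e
IsSNPR : ∀ {A} → BT A → Op → Set
IsSNPR t (e , f) = Valid t e × Valid t f × ¬ (e ≡ []) × ¬ (e ≼ f)

applySNPR : ∀ {A} → BT A → Op → BT A
applySNPR t (e , f) = graft (pruneAt t e) (mapPos e f) (sub t e)

-- NNI operation (f, e, g): e = q ++ [c] an inner edge (not the root edge, head
-- is an inner vertex), g = e ++ [d] a child edge of its head, f = q ++ [flip c]
-- the sibling edge of e.
NNIData : Set
NNIData = Path × Dir × Dir

IsNNI : ∀ {A} → BT A → NNIData → Set
IsNNI t (q , c , d) = Valid t (q ++ c ∷ d ∷ [])

nniOp : NNIData → Op
nniOp (q , c , d) = (q ++ c ∷ d ∷ [] , q ++ flip c ∷ [])

applyNNI : ∀ {A} → BT A → NNIData → BT A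
applyNNI t σ = applySNPR t (nniOp σ)

module Submission where

open import Defs
open import Data.Empty using (⊥; ⊥-elim)
open import Data.Fin using (Fin)
open import Data.List using (List; []; _∷_; _++_; map; length)
open import Data.List.Membership.Propositional using (_∈_)
open import Data.List.Membership.Propositional.Properties using (∈-map⁺; ∈-++⁺ˡ; ∈-++⁺ʳ)
open import Data.List.Membership.Propositional.Properties.WithK using (unique∧set⇒bag)
open import Data.List.Properties using (map-++)
open import Data.List.Relation.Binary.BagAndSetEquality using (∼bag⇒↭)
open import Data.List.Relation.Binary.Permutation.Propositional using (↭-sym; ↭⇒↭ₛ)
open import Data.List.Relation.Binary.Permutation.Propositional.Properties using (↭-length)
open import Data.List.Relation.Binary.Permutation.Setoid.Properties using (Unique-resp-↭)
open import Data.List.Relation.Unary.All using (All; []; _∷_; lookup)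
import Data.List.Relation.Unary.All as All
open import Data.List.Relation.Unary.All.Properties using (++⁻ˡ; ++⁻ʳ) renaming (map⁺ to All-map⁺)
open import Data.List.Relation.Unary.AllPairs using ([]; _∷_)
open import Data.List.Relation.Unary.Any using (here; there)
open import Data.List.Relation.Unary.Unique.Propositional using (Unique)
open import Data.List.Relation.Unary.Unique.Propositional.Properties using (allFin⁺) renaming (map⁺ to Unique-map⁺)
open import Data.Nat using (ℕ; _≤_; s≤s)
open import Data.Product using (_×_; _,_; Σ; ∃-syntax)
open import Data.Sum using (_⊎_; inj₁; inj₂)
open import Data.Unit using (⊤)
open import Function.Bundles using (mk⇔)
open import Relation.Binary.PropositionalEquality
  using (_≡_; _≢_; refl; sym; trans; cong; cong₂; subst; subst₂; setoid)
open import Relation.Nullary using (¬_; contradiction)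

-- Write T = node a b.  An SNPR operation either acts inside a or inside b, or it moves a subtree
-- across the root of T.  Comparing the leaves on the two sides of the root of the results shows
-- that two distinct operations with the same nontrivial result either act inside the same side
-- (and we recurse), or are two of the three operations of an NNI triangle: for a quartet
-- ((x , y) , w), moving x onto the parent edge, moving y onto w and moving w onto y all yield
-- (x , (y , w)), and the second of these is an NNI.  Every operation determines the triangle it
-- belongs to, so a maximal set of pairwise redundant operations is a whole triangle and has three
-- elements.  Mirroring the tree halves the case analysis.

unique-++⁻ : ∀ {B : Set} (xs : List B) {ys} → Unique (xs ++ ys) →
  Unique xs × Unique ys × (∀ {z} → z ∈ xs → z ∈ ys → ⊥)
unique-++⁻ [] u = [] , u , λ ()
unique-++⁻ (x ∷ xs) (x∉ ∷ u) with unique-++⁻ xs u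
... | uxs , uys , disjoint = (++⁻ˡ xs x∉ ∷ uxs) , uys , λ where
  (here refl) k → lookup (++⁻ʳ xs x∉) k refl
  (there m) k → disjoint m k

unique-same-members⇒same-length : ∀ {B : Set} {xs ys : List B} → Unique xs → Unique ys →
  (∀ {z} → z ∈ xs → z ∈ ys) → (∀ {z} → z ∈ ys → z ∈ xs) → length xs ≡ length ys
unique-same-members⇒same-length uxs uys to from = ↭-length (∼bag⇒↭ (unique∧set⇒bag uxs uys (mk⇔ to from)))

-- Isomorphism and leaves

module _ {A : Set} where

  ≅-refl : ∀ {t : BT A} → t ≅ t
  ≅-refl {leaf x} = leaf
  ≅-refl {node a b} = node ≅-refl ≅-refl

  ≅-sym : ∀ {s t : BT A} → s ≅ t → t ≅ s
  ≅-sym leaf = leaf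
  ≅-sym (node p q) = node (≅-sym p) (≅-sym q)
  ≅-sym (swap p q) = swap (≅-sym q) (≅-sym p)

  ≅-trans : ∀ {s t u : BT A} → s ≅ t → t ≅ u → s ≅ u
  ≅-trans leaf q = q
  ≅-trans (node p q) (node r s) = node (≅-trans p r) (≅-trans q s)
  ≅-trans (node p q) (swap r s) = swap (≅-trans p r) (≅-trans q s)
  ≅-trans (swap p q) (node r s) = swap (≅-trans p s) (≅-trans q r)
  ≅-trans (swap p q) (swap r s) = node (≅-trans p s) (≅-trans q r)

  node-≅⁻ : ∀ {a b c d : BT A} → node a b ≅ node c d → (a ≅ c × b ≅ d) ⊎ (a ≅ d × b ≅ c)
  node-≅⁻ (node p q) = inj₁ (p , q)
  node-≅⁻ (swap p q) = inj₂ (p , q)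

  node-≇ : ∀ {a b c d : BT A} → ¬ (a ≅ c × b ≅ d) → ¬ (a ≅ d × b ≅ c) → ¬ (node a b ≅ node c d)
  node-≇ straight crossed h with node-≅⁻ h
  ... | inj₁ p = straight p
  ... | inj₂ p = crossed p

  data _∈ₜ_ (z : A) : BT A → Set where
    atLeaf : z ∈ₜ leaf z
    inL : ∀ {a b} → z ∈ₜ a → z ∈ₜ node a b
    inR : ∀ {a b} → z ∈ₜ b → z ∈ₜ node a b

  Disjoint : BT A → BT A → Set
  Disjoint u v = ∀ {z} → z ∈ₜ u → z ∈ₜ v → ⊥

  Distinct : BT A → Set
  Distinct (leaf _) = ⊤
  Distinct (node a b) = Distinct a × Distinct b × Disjoint a b

  leftmost : BT A → A
  leftmost (leaf x) = x
  leftmost (node a _) = leftmost a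

  leftmost∈ : (t : BT A) → leftmost t ∈ₜ t
  leftmost∈ (leaf x) = atLeaf
  leftmost∈ (node a b) = inL (leftmost∈ a)

  ∈-resp-≅ : ∀ {s t : BT A} {z} → s ≅ t → z ∈ₜ s → z ∈ₜ t
  ∈-resp-≅ leaf m = m
  ∈-resp-≅ (node p q) (inL m) = inL (∈-resp-≅ p m)
  ∈-resp-≅ (node p q) (inR m) = inR (∈-resp-≅ q m)
  ∈-resp-≅ (swap p q) (inL m) = inR (∈-resp-≅ p m)
  ∈-resp-≅ (swap p q) (inR m) = inL (∈-resp-≅ q m)

  ≇-by-leaf : ∀ {s t : BT A} {z} → z ∈ₜ s → ¬ (z ∈ₜ t) → ¬ (s ≅ t)
  ≇-by-leaf m n h = n (∈-resp-≅ h m)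

  ≇-by-leaf′ : ∀ {s t : BT A} {z} → ¬ (z ∈ₜ s) → z ∈ₜ t → ¬ (s ≅ t)
  ≇-by-leaf′ n m h = n (∈-resp-≅ (≅-sym h) m)

  ∈-graft⁻ : ∀ {s x z} r → z ∈ₜ graft s r x → z ∈ₜ s ⊎ z ∈ₜ x
  ∈-graft⁻ {s} [] (inL m) = inj₁ m
  ∈-graft⁻ {s} [] (inR m) = inj₂ m
  ∈-graft⁻ {leaf _} (_ ∷ _) (inL m) = inj₁ m
  ∈-graft⁻ {leaf _} (_ ∷ _) (inR m) = inj₂ m
  ∈-graft⁻ {node a b} (L ∷ r) (inL m) with ∈-graft⁻ r m
  ... | inj₁ k = inj₁ (inL k)
  ... | inj₂ k = inj₂ k
  ∈-graft⁻ {node a b} (L ∷ r) (inR m) = inj₁ (inR m)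
  ∈-graft⁻ {node a b} (R ∷ r) (inL m) = inj₁ (inL m)
  ∈-graft⁻ {node a b} (R ∷ r) (inR m) with ∈-graft⁻ r m
  ... | inj₁ k = inj₁ (inR k)
  ... | inj₂ k = inj₂ k

  ∈-graft⁺ˡ : ∀ {s x z} r → z ∈ₜ s → z ∈ₜ graft s r x
  ∈-graft⁺ˡ {s} [] m = inL m
  ∈-graft⁺ˡ {leaf _} (_ ∷ _) m = inL m
  ∈-graft⁺ˡ {node a b} (L ∷ r) (inL m) = inL (∈-graft⁺ˡ r m)
  ∈-graft⁺ˡ {node a b} (L ∷ r) (inR m) = inR m
  ∈-graft⁺ˡ {node a b} (R ∷ r) (inL m) = inL m
  ∈-graft⁺ˡ {node a b} (R ∷ r) (inR m) = inR (∈-graft⁺ˡ r m)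

  ∈-graft⁺ʳ : ∀ {s x z} r → z ∈ₜ x → z ∈ₜ graft s r x
  ∈-graft⁺ʳ {s} [] m = inR m
  ∈-graft⁺ʳ {leaf _} (_ ∷ _) m = inR m
  ∈-graft⁺ʳ {node a b} (L ∷ r) m = inL (∈-graft⁺ʳ r m)
  ∈-graft⁺ʳ {node a b} (R ∷ r) m = inR (∈-graft⁺ʳ r m)

  ∉-graft : ∀ {s x z} r → ¬ (z ∈ₜ s) → ¬ (z ∈ₜ x) → ¬ (z ∈ₜ graft s r x)
  ∉-graft r ∉s ∉x m with ∈-graft⁻ r m
  ... | inj₁ k = ∉s k
  ... | inj₂ k = ∉x k

  ∈-sub⁻ : ∀ {t z} e → z ∈ₜ sub t e → z ∈ₜ t
  ∈-sub⁻ [] m = m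
  ∈-sub⁻ {leaf _} (_ ∷ _) m = m
  ∈-sub⁻ {node a b} (L ∷ e) m = inL (∈-sub⁻ e m)
  ∈-sub⁻ {node a b} (R ∷ e) m = inR (∈-sub⁻ e m)

  ∈-prune⁻ : ∀ {t z} e → z ∈ₜ pruneAt t e → z ∈ₜ t
  ∈-prune⁻ {leaf _} [] m = m
  ∈-prune⁻ {leaf _} (_ ∷ _) m = m
  ∈-prune⁻ {node a b} [] m = m
  ∈-prune⁻ {node a b} (L ∷ []) m = inR m
  ∈-prune⁻ {node a b} (R ∷ []) m = inL m
  ∈-prune⁻ {node a b} (L ∷ d ∷ e) (inL m) = inL (∈-prune⁻ (d ∷ e) m)
  ∈-prune⁻ {node a b} (L ∷ d ∷ e) (inR m) = inR m
  ∈-prune⁻ {node a b} (R ∷ d ∷ e) (inL m) = inL m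
  ∈-prune⁻ {node a b} (R ∷ d ∷ e) (inR m) = inR (∈-prune⁻ (d ∷ e) m)

  ∈-sub⊎prune : ∀ {t z d e} → Valid t (d ∷ e) → z ∈ₜ t → z ∈ₜ sub t (d ∷ e) ⊎ z ∈ₜ pruneAt t (d ∷ e)
  ∈-sub⊎prune {e = []} (goL v) (inL m) = inj₁ m
  ∈-sub⊎prune {e = []} (goL v) (inR m) = inj₂ m
  ∈-sub⊎prune {e = []} (goR v) (inL m) = inj₂ m
  ∈-sub⊎prune {e = []} (goR v) (inR m) = inj₁ m
  ∈-sub⊎prune {e = _ ∷ _} (goL v) (inL m) with ∈-sub⊎prune v m
  ... | inj₁ k = inj₁ k
  ... | inj₂ k = inj₂ (inL k)
  ∈-sub⊎prune {e = _ ∷ _} (goL v) (inR m) = inj₂ (inR m)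
  ∈-sub⊎prune {e = _ ∷ _} (goR v) (inL m) = inj₂ (inL m)
  ∈-sub⊎prune {e = _ ∷ _} (goR v) (inR m) with ∈-sub⊎prune v m
  ... | inj₁ k = inj₁ k
  ... | inj₂ k = inj₂ (inR k)

  ∈-prune⁺ : ∀ {t z d e} → Valid t (d ∷ e) → z ∈ₜ t → ¬ (z ∈ₜ sub t (d ∷ e)) → z ∈ₜ pruneAt t (d ∷ e)
  ∈-prune⁺ v m ∉sub with ∈-sub⊎prune v m
  ... | inj₁ k = ⊥-elim (∉sub k)
  ... | inj₂ k = k

  ∈-sub⁺ : ∀ {t z d e} → Valid t (d ∷ e) → z ∈ₜ t → ¬ (z ∈ₜ pruneAt t (d ∷ e)) → z ∈ₜ sub t (d ∷ e)
  ∈-sub⁺ v m ∉prune with ∈-sub⊎prune v m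
  ... | inj₁ k = k
  ... | inj₂ k = ⊥-elim (∉prune k)

  sub-prune-disjoint : ∀ {t d e} → Distinct t → Valid t (d ∷ e) → Disjoint (sub t (d ∷ e)) (pruneAt t (d ∷ e))
  sub-prune-disjoint {e = []} (_ , _ , D) (goL v) m k = D m k
  sub-prune-disjoint {e = []} (_ , _ , D) (goR v) m k = D k m
  sub-prune-disjoint {e = d ∷ e} (Dᵃ , _ , D) (goL v) m (inL k) = sub-prune-disjoint Dᵃ v m k
  sub-prune-disjoint {e = d ∷ e} (_ , _ , D) (goL v) m (inR k) = D (∈-sub⁻ (d ∷ e) m) k
  sub-prune-disjoint {e = d ∷ e} (_ , _ , D) (goR v) m (inL k) = D k (∈-sub⁻ (d ∷ e) m)
  sub-prune-disjoint {e = d ∷ e} (_ , Dᵇ , D) (goR v) m (inR k) = sub-prune-disjoint Dᵇ v m k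

  ∈-snpr⁻ : ∀ {t z} θ → z ∈ₜ applySNPR t θ → z ∈ₜ t
  ∈-snpr⁻ (e , f) m with ∈-graft⁻ (mapPos e f) m
  ... | inj₁ k = ∈-prune⁻ e k
  ... | inj₂ k = ∈-sub⁻ e k

  ∈-snpr⁺ : ∀ {t z d e} f → Valid t (d ∷ e) → z ∈ₜ t → z ∈ₜ applySNPR t (d ∷ e , f)
  ∈-snpr⁺ {d = d} {e} f v m with ∈-sub⊎prune v m
  ... | inj₁ k = ∈-graft⁺ʳ (mapPos (d ∷ e) f) k
  ... | inj₂ k = ∈-graft⁺ˡ (mapPos (d ∷ e) f) k

  graft-≅-scion⊆ : ∀ {s s' x x' : BT A} {r r' z} → Disjoint x s' → graft s r x ≅ graft s' r' x' → z ∈ₜ x → z ∈ₜ x'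
  graft-≅-scion⊆ {r = r} {r'} D h m with ∈-graft⁻ r' (∈-resp-≅ h (∈-graft⁺ʳ r m))
  ... | inj₁ k = ⊥-elim (D m k)
  ... | inj₂ k = k

  graft-root≇graft-below : ∀ {s x : BT A} {d r} → Distinct s → Disjoint s x → Valid s (d ∷ r) →
    ¬ (graft s [] x ≅ graft s (d ∷ r) x)
  graft-root≇graft-below {node s₁ s₂} {x} {L} {r} (_ , _ , D) Dx (goL _) =
    node-≇ (λ (h , _) → ≇-by-leaf (inR (leftmost∈ s₂)) (∉-graft r (λ m → D m (leftmost∈ s₂)) (λ m → Dx (inR (leftmost∈ s₂)) m)) h)
           (λ (h , _) → ≇-by-leaf (inL (leftmost∈ s₁)) (λ m → D (leftmost∈ s₁) m) h)
  graft-root≇graft-below {node s₁ s₂} {x} {R} {r} (_ , _ , D) Dx (goR _) =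
    node-≇ (λ (h , _) → ≇-by-leaf (inR (leftmost∈ s₂)) (λ m → D m (leftmost∈ s₂)) h)
           (λ (h , _) → ≇-by-leaf (inL (leftmost∈ s₁)) (∉-graft r (λ m → D (leftmost∈ s₁) m) (λ m → Dx (inL (leftmost∈ s₁)) m)) h)

  graft-position-injective : ∀ {s x : BT A} {r r'} → Distinct s → Disjoint s x → Valid s r → Valid s r' →
    graft s r x ≅ graft s r' x → r ≡ r'
  graft-position-injective {r = []} {[]} _ _ _ _ _ = refl
  graft-position-injective {r = []} {_ ∷ _} Ds Dx _ v' h = ⊥-elim (graft-root≇graft-below Ds Dx v' h)
  graft-position-injective {r = _ ∷ _} {[]} Ds Dx v _ h = ⊥-elim (graft-root≇graft-below Ds Dx v (≅-sym h))
  graft-position-injective {node s₁ s₂} {x} {L ∷ r} {L ∷ r'} (D₁ , _ , _) Dx (goL v) (goL v') h with node-≅⁻ h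
  ... | inj₁ (h₁ , _) = cong (L ∷_) (graft-position-injective D₁ (λ m → Dx (inL m)) v v' h₁)
  ... | inj₂ (h₁ , _) = ⊥-elim (≇-by-leaf (∈-graft⁺ʳ r (leftmost∈ x)) (λ m → Dx (inR m) (leftmost∈ x)) h₁)
  graft-position-injective {node s₁ s₂} {x} {R ∷ r} {R ∷ r'} (_ , D₂ , D) Dx (goR v) (goR v') h with node-≅⁻ h
  ... | inj₁ (_ , h₂) = cong (R ∷_) (graft-position-injective D₂ (λ m → Dx (inR m)) v v' h₂)
  ... | inj₂ (h₁ , _) = ⊥-elim (≇-by-leaf (leftmost∈ s₁) (∉-graft r' (λ m → D (leftmost∈ s₁) m) (λ m → Dx (inL (leftmost∈ s₁)) m)) h₁)
  graft-position-injective {node s₁ s₂} {x} {L ∷ r} {R ∷ r'} (_ , _ , D) Dx (goL _) (goR _) h = contradiction h (node-≇ (λ (h₁ , _) → ≇-by-leaf (∈-graft⁺ʳ r (leftmost∈ x)) (λ m → Dx (inL m) (leftmost∈ x)) h₁)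
           (λ (h₁ , _) → ≇-by-leaf (∈-graft⁺ˡ r (leftmost∈ s₁)) (∉-graft r' (λ m → D (leftmost∈ s₁) m) (λ m → Dx (inL (leftmost∈ s₁)) m)) h₁))
  graft-position-injective {node s₁ s₂} {x} {R ∷ r} {L ∷ r'} (_ , _ , D) Dx (goR _) (goL _) h = contradiction h (node-≇ (λ (h₁ , _) → ≇-by-leaf′ (λ m → Dx (inL m) (leftmost∈ x)) (∈-graft⁺ʳ r' (leftmost∈ x)) h₁)
           (λ (h₁ , _) → ≇-by-leaf (leftmost∈ s₁) (λ m → D (leftmost∈ s₁) m) h₁))

  graft-exchange⇒root : ∀ {s x : BT A} {r r'} → Distinct s → Disjoint s x → Valid s r → Valid x r' →
    graft s r x ≅ graft x r' s → r ≡ []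
  graft-exchange⇒root {r = []} _ _ _ _ _ = refl
  graft-exchange⇒root {node s₁ s₂} {x} {L ∷ p} {[]} (_ , _ , D) Dx (goL _) _ h = contradiction h (node-≇
    (λ (_ , h₂) → ≇-by-leaf′ (λ m → D (leftmost∈ s₁) m) (inL (leftmost∈ s₁)) h₂)
    (λ (_ , h₂) → ≇-by-leaf (leftmost∈ s₂) (λ m → Dx (inR (leftmost∈ s₂)) m) h₂))
  graft-exchange⇒root {node s₁ s₂} {node x₁ x₂} {L ∷ p} {L ∷ p'} _ Dx (goL _) (goL _) h = contradiction h (node-≇
    (λ (_ , h₂) → ≇-by-leaf (leftmost∈ s₂) (λ m → Dx (inR (leftmost∈ s₂)) (inR m)) h₂)
    (λ (_ , h₂) → ≇-by-leaf′ (λ m → Dx (inR m) (inL (leftmost∈ x₁))) (∈-graft⁺ˡ p' (leftmost∈ x₁)) h₂))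
  graft-exchange⇒root {node s₁ s₂} {node x₁ x₂} {L ∷ p} {R ∷ p'} _ Dx (goL _) (goR _) h = contradiction h (node-≇
    (λ (_ , h₂) → ≇-by-leaf′ (λ m → Dx (inR m) (inR (leftmost∈ x₂))) (∈-graft⁺ˡ p' (leftmost∈ x₂)) h₂)
    (λ (_ , h₂) → ≇-by-leaf (leftmost∈ s₂) (λ m → Dx (inR (leftmost∈ s₂)) (inL m)) h₂))
  graft-exchange⇒root {node s₁ s₂} {x} {R ∷ p} {[]} (_ , _ , D) Dx (goR _) _ h = contradiction h (node-≇
    (λ (h₁ , _) → ≇-by-leaf (leftmost∈ s₁) (λ m → Dx (inL (leftmost∈ s₁)) m) h₁)
    (λ (h₁ , _) → ≇-by-leaf′ (λ m → D m (leftmost∈ s₂)) (inR (leftmost∈ s₂)) h₁))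
  graft-exchange⇒root {node s₁ s₂} {node x₁ x₂} {R ∷ p} {L ∷ p'} _ Dx (goR _) (goL _) h = contradiction h (node-≇
    (λ (h₁ , _) → ≇-by-leaf′ (λ m → Dx (inL m) (inL (leftmost∈ x₁))) (∈-graft⁺ˡ p' (leftmost∈ x₁)) h₁)
    (λ (h₁ , _) → ≇-by-leaf (leftmost∈ s₁) (λ m → Dx (inL (leftmost∈ s₁)) (inR m)) h₁))
  graft-exchange⇒root {node s₁ s₂} {node x₁ x₂} {R ∷ p} {R ∷ p'} _ Dx (goR _) (goR _) h = contradiction h (node-≇
    (λ (h₁ , _) → ≇-by-leaf (leftmost∈ s₁) (λ m → Dx (inL (leftmost∈ s₁)) (inL m)) h₁)
    (λ (h₁ , _) → ≇-by-leaf′ (λ m → Dx (inL m) (inR (leftmost∈ x₂))) (∈-graft⁺ˡ p' (leftmost∈ x₂)) h₁))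

  node≅graft⇒root : ∀ {u w x : BT A} {r} → Disjoint u w → Valid w r → node u w ≅ graft w r x → r ≡ []
  node≅graft⇒root {r = []} _ _ _ = refl
  node≅graft⇒root {u} {node w₁ w₂} {x} {L ∷ r} D (goL _) h = contradiction h (node-≇
    (λ (h₁ , _) → ≇-by-leaf′ (λ m → D m (inL (leftmost∈ w₁))) (∈-graft⁺ˡ r (leftmost∈ w₁)) h₁)
    (λ (h₁ , _) → ≇-by-leaf (leftmost∈ u) (λ m → D (leftmost∈ u) (inR m)) h₁))
  node≅graft⇒root {u} {node w₁ w₂} {x} {R ∷ r} D (goR _) h = contradiction h (node-≇
    (λ (h₁ , _) → ≇-by-leaf (leftmost∈ u) (λ m → D (leftmost∈ u) (inL m)) h₁)
    (λ (h₁ , _) → ≇-by-leaf′ (λ m → D m (inR (leftmost∈ w₂))) (∈-graft⁺ˡ r (leftmost∈ w₂)) h₁))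

  sub-injective : ∀ {t : BT A} {q q'} → Distinct t → Valid t q → Valid t q' →
    (∀ {z} → z ∈ₜ sub t q → z ∈ₜ sub t q') → (∀ {z} → z ∈ₜ sub t q' → z ∈ₜ sub t q) → q ≡ q'
  sub-injective {q = []} {[]} _ _ _ _ _ = refl
  sub-injective {node a b} {[]} {L ∷ q'} (_ , _ , D) _ (goL _) f _ = ⊥-elim (D (∈-sub⁻ q' (f (inR (leftmost∈ b)))) (leftmost∈ b))
  sub-injective {node a b} {[]} {R ∷ q'} (_ , _ , D) _ (goR _) f _ = ⊥-elim (D (leftmost∈ a) (∈-sub⁻ q' (f (inL (leftmost∈ a)))))
  sub-injective {node a b} {L ∷ q} {[]} (_ , _ , D) (goL _) _ _ g = ⊥-elim (D (∈-sub⁻ q (g (inR (leftmost∈ b)))) (leftmost∈ b))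
  sub-injective {node a b} {R ∷ q} {[]} (_ , _ , D) (goR _) _ _ g = ⊥-elim (D (leftmost∈ a) (∈-sub⁻ q (g (inL (leftmost∈ a)))))
  sub-injective {node a b} {L ∷ q} {L ∷ q'} (Dᵃ , _ , _) (goL v) (goL v') f g = cong (L ∷_) (sub-injective Dᵃ v v' f g)
  sub-injective {node a b} {R ∷ q} {R ∷ q'} (_ , Dᵇ , _) (goR v) (goR v') f g = cong (R ∷_) (sub-injective Dᵇ v v' f g)
  sub-injective {node a b} {L ∷ q} {R ∷ q'} (_ , _ , D) (goL _) (goR _) f _ =
    ⊥-elim (D (∈-sub⁻ q (leftmost∈ (sub a q))) (∈-sub⁻ q' (f (leftmost∈ (sub a q)))))
  sub-injective {node a b} {R ∷ q} {L ∷ q'} (_ , _ , D) (goR _) (goL _) f _ =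
    ⊥-elim (D (∈-sub⁻ q' (f (leftmost∈ (sub b q)))) (∈-sub⁻ q (leftmost∈ (sub b q))))

  sub-≅⇒≡ : ∀ {t : BT A} {q q'} → Distinct t → Valid t q → Valid t q' → sub t q ≅ sub t q' → q ≡ q'
  sub-≅⇒≡ D v v' h = sub-injective D v v' (∈-resp-≅ h) (∈-resp-≅ (≅-sym h))

  prune≅right⇒left : ∀ {u w : BT A} {d p} → Distinct (node u w) → Valid (node u w) (d ∷ p) →
    w ≅ pruneAt (node u w) (d ∷ p) → L ∷ [] ≡ d ∷ p
  prune≅right⇒left {u} {w} {d} {p} D@(_ , _ , Dᵘʷ) v h = sub-injective D (goL here) v u⊆sub sub⊆u
    where
      u⊆sub : ∀ {z} → z ∈ₜ u → z ∈ₜ sub (node u w) (d ∷ p)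
      u⊆sub k = ∈-sub⁺ v (inL k) (λ m → Dᵘʷ k (∈-resp-≅ (≅-sym h) m))
      sub⊆u : ∀ {z} → z ∈ₜ sub (node u w) (d ∷ p) → z ∈ₜ u
      sub⊆u m with ∈-sub⁻ {t = node u w} (d ∷ p) m
      ... | inL k = k
      ... | inR k = ⊥-elim (sub-prune-disjoint D v m (∈-resp-≅ h k))

  prune≅left⇒right : ∀ {u w : BT A} {d p} → Distinct (node u w) → Valid (node u w) (d ∷ p) →
    u ≅ pruneAt (node u w) (d ∷ p) → R ∷ [] ≡ d ∷ p
  prune≅left⇒right {u} {w} {d} {p} D@(_ , _ , Dᵘʷ) v h = sub-injective D (goR here) v w⊆sub sub⊆w
    where
      w⊆sub : ∀ {z} → z ∈ₜ w → z ∈ₜ sub (node u w) (d ∷ p)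
      w⊆sub k = ∈-sub⁺ v (inR k) (λ m → Dᵘʷ (∈-resp-≅ (≅-sym h) m) k)
      sub⊆w : ∀ {z} → z ∈ₜ sub (node u w) (d ∷ p) → z ∈ₜ w
      sub⊆w m with ∈-sub⁻ {t = node u w} (d ∷ p) m
      ... | inR k = k
      ... | inL k = ⊥-elim (sub-prune-disjoint D v m (∈-resp-≅ h k))

  sub≅prune⇒covered : ∀ {a : BT A} {q d' p' w} → Valid a (d' ∷ p') → sub a q ≅ pruneAt a (d' ∷ p') →
    w ∈ₜ a → ¬ (w ∈ₜ sub a q) → ¬ (w ∈ₜ sub a (d' ∷ p')) → ⊥
  sub≅prune⇒covered v' h m ∉q ∉q' = ∉q (∈-resp-≅ (≅-sym h) (∈-prune⁺ v' m ∉q'))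

  sub≅prune⇒siblings : ∀ {a : BT A} {d p d' p'} → Distinct a → Valid a (d ∷ p) → Valid a (d' ∷ p') →
    sub a (d ∷ p) ≅ pruneAt a (d' ∷ p') →
    (d ∷ p ≡ L ∷ [] × d' ∷ p' ≡ R ∷ []) ⊎ (d ∷ p ≡ R ∷ [] × d' ∷ p' ≡ L ∷ [])
  sub≅prune⇒siblings {node _ _} {L} {[]} {R} {[]} _ _ _ _ = inj₁ (refl , refl)
  sub≅prune⇒siblings {node _ _} {R} {[]} {L} {[]} _ _ _ _ = inj₂ (refl , refl)
  sub≅prune⇒siblings {node a₁ a₂} {L} {p} {L} {p'} (_ , _ , D) (goL _) v' h =
    ⊥-elim (sub≅prune⇒covered {q = L ∷ p} v' h (inR (leftmost∈ a₂))
      (λ m → D (∈-sub⁻ p m) (leftmost∈ a₂)) (λ m → D (∈-sub⁻ p' m) (leftmost∈ a₂)))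
  sub≅prune⇒siblings {node a₁ a₂} {R} {p} {R} {p'} (_ , _ , D) (goR _) v' h =
    ⊥-elim (sub≅prune⇒covered {q = R ∷ p} v' h (inL (leftmost∈ a₁))
      (λ m → D (leftmost∈ a₁) (∈-sub⁻ p m)) (λ m → D (leftmost∈ a₁) (∈-sub⁻ p' m)))
  sub≅prune⇒siblings {node a₁ a₂} {L} {[]} {R} {d₁ ∷ p₁} (_ , D₂ , D) (goL _) v'@(goR w') h =
    ⊥-elim (sub≅prune⇒covered {q = L ∷ []} v' h (inR (∈-prune⁻ (d₁ ∷ p₁) (leftmost∈ (pruneAt a₂ (d₁ ∷ p₁)))))
      (λ m → D m (∈-prune⁻ (d₁ ∷ p₁) (leftmost∈ (pruneAt a₂ (d₁ ∷ p₁)))))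
      (λ m → sub-prune-disjoint D₂ w' m (leftmost∈ (pruneAt a₂ (d₁ ∷ p₁)))))
  sub≅prune⇒siblings {node a₁ a₂} {R} {[]} {L} {d₁ ∷ p₁} (D₁ , _ , D) (goR _) v'@(goL w') h =
    ⊥-elim (sub≅prune⇒covered {q = R ∷ []} v' h (inL (∈-prune⁻ (d₁ ∷ p₁) (leftmost∈ (pruneAt a₁ (d₁ ∷ p₁)))))
      (λ m → D (∈-prune⁻ (d₁ ∷ p₁) (leftmost∈ (pruneAt a₁ (d₁ ∷ p₁)))) m)
      (λ m → sub-prune-disjoint D₁ w' m (leftmost∈ (pruneAt a₁ (d₁ ∷ p₁)))))
  sub≅prune⇒siblings {node a₁ a₂} {L} {d₀ ∷ p₀} {R} {p'} (D₁ , _ , D) (goL v) v'@(goR _) h =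
    ⊥-elim (sub≅prune⇒covered {q = L ∷ d₀ ∷ p₀} v' h (inL (∈-prune⁻ (d₀ ∷ p₀) (leftmost∈ (pruneAt a₁ (d₀ ∷ p₀)))))
      (λ m → sub-prune-disjoint D₁ v m (leftmost∈ (pruneAt a₁ (d₀ ∷ p₀))))
      (λ m → D (∈-prune⁻ (d₀ ∷ p₀) (leftmost∈ (pruneAt a₁ (d₀ ∷ p₀)))) (∈-sub⁻ p' m)))
  sub≅prune⇒siblings {node a₁ a₂} {R} {d₀ ∷ p₀} {L} {p'} (_ , D₂ , D) (goR v) v'@(goL _) h =
    ⊥-elim (sub≅prune⇒covered {q = R ∷ d₀ ∷ p₀} v' h (inR (∈-prune⁻ (d₀ ∷ p₀) (leftmost∈ (pruneAt a₂ (d₀ ∷ p₀)))))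
      (λ m → sub-prune-disjoint D₂ v m (leftmost∈ (pruneAt a₂ (d₀ ∷ p₀))))
      (λ m → D (∈-sub⁻ p' m) (∈-prune⁻ (d₀ ∷ p₀) (leftmost∈ (pruneAt a₂ (d₀ ∷ p₀))))))

module _ {A : Set} where

  ∈ₜ⇒∈leaves : ∀ {t : BT A} {z} → z ∈ₜ t → z ∈ leaves t
  ∈ₜ⇒∈leaves atLeaf = here refl
  ∈ₜ⇒∈leaves (inL m) = ∈-++⁺ˡ (∈ₜ⇒∈leaves m)
  ∈ₜ⇒∈leaves {node a _} (inR m) = ∈-++⁺ʳ (leaves a) (∈ₜ⇒∈leaves m)

  unique-leaves⇒distinct : ∀ (t : BT A) → Unique (leaves t) → Distinct t
  unique-leaves⇒distinct (leaf _) _ = _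
  unique-leaves⇒distinct (node a b) u with unique-++⁻ (leaves a) u
  ... | ua , ub , disjoint =
    unique-leaves⇒distinct a ua , unique-leaves⇒distinct b ub , λ m k → disjoint (∈ₜ⇒∈leaves m) (∈ₜ⇒∈leaves k)

phylo⇒distinct : ∀ {n} (T : BT (Fin n)) → IsPhylo T → Distinct T
phylo⇒distinct {n} T ph = unique-leaves⇒distinct T (Unique-resp-↭ (setoid (Fin n)) (↭⇒↭ₛ (↭-sym ph)) (allFin⁺ n))

-- NNI triangles

liftOp : Dir → Op → Op
liftOp d (e , f) = d ∷ e , d ∷ f

liftOp-injective : ∀ {d θ θ'} → liftOp d θ ≡ liftOp d θ' → θ ≡ θ'
liftOp-injective {θ = _ , _} {_ , _} refl = refl

-- For σ = (q , c , d) the NNI moves g = q ++ [c , d] onto the sibling q ++ [flip c] of its parent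
-- edge; the same tree arises by moving the other child q ++ [c , flip d] up onto q, or by moving
-- q ++ [flip c] onto g.
triangle : NNIData → List Op
triangle σ@(q , c , d) = (q ++ c ∷ flip d ∷ [] , q) ∷ nniOp σ ∷ (q ++ flip c ∷ [] , q ++ c ∷ d ∷ []) ∷ []

triangleOf : Op → List Op
triangleOf (L ∷ e , L ∷ f) = map (liftOp L) (triangleOf (e , f))
triangleOf (R ∷ e , R ∷ f) = map (liftOp R) (triangleOf (e , f))
triangleOf (c ∷ d ∷ [] , []) = triangle ([] , c , flip d)
triangleOf (c ∷ d ∷ [] , _ ∷ []) = triangle ([] , c , d)
triangleOf (_ ∷ [] , c ∷ d ∷ []) = triangle ([] , c , d)
triangleOf _ = []

triangleOf-triangle : ∀ σ → All (λ θ → triangleOf θ ≡ triangle σ) (triangle σ)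
triangleOf-triangle ([] , L , L) = refl ∷ refl ∷ refl ∷ []
triangleOf-triangle ([] , L , R) = refl ∷ refl ∷ refl ∷ []
triangleOf-triangle ([] , R , L) = refl ∷ refl ∷ refl ∷ []
triangleOf-triangle ([] , R , R) = refl ∷ refl ∷ refl ∷ []
triangleOf-triangle (L ∷ q , c , d) = All-map⁺ {f = liftOp L} (All.map (cong (map (liftOp L))) (triangleOf-triangle (q , c , d)))
triangleOf-triangle (R ∷ q , c , d) = All-map⁺ {f = liftOp R} (All.map (cong (map (liftOp R))) (triangleOf-triangle (q , c , d)))

triangle-unique : ∀ σ → Unique (triangle σ)
triangle-unique ([] , c , d) = ((λ ()) ∷ (λ ()) ∷ []) ∷ ((λ ()) ∷ []) ∷ [] ∷ []
triangle-unique (_ ∷ q , c , d) = Unique-map⁺ liftOp-injective (triangle-unique (q , c , d))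

triangle-≡ : ∀ {θ} σ σ' → θ ∈ triangle σ → θ ∈ triangle σ' → triangle σ ≡ triangle σ'
triangle-≡ σ σ' m m' = trans (sym (lookup (triangleOf-triangle σ) m)) (lookup (triangleOf-triangle σ') m')

module _ {A : Set} where

  snpr-liftˡ : ∀ {a b : BT A} {θ} → IsSNPR a θ → IsSNPR (node a b) (liftOp L θ)
  snpr-liftˡ (ve , vf , _ , e⋠f) = goL ve , goL vf , (λ ()) , λ { (cons p) → e⋠f p }

  snpr-liftʳ : ∀ {a b : BT A} {θ} → IsSNPR b θ → IsSNPR (node a b) (liftOp R θ)
  snpr-liftʳ (ve , vf , _ , e⋠f) = goR ve , goR vf , (λ ()) , λ { (cons p) → e⋠f p }

  applySNPR-liftˡ : ∀ {a b : BT A} {θ} → IsSNPR a θ → applySNPR (node a b) (liftOp L θ) ≡ node (applySNPR a θ) b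
  applySNPR-liftˡ {θ = [] , _} (_ , _ , e≢[] , _) = ⊥-elim (e≢[] refl)
  applySNPR-liftˡ {θ = _ ∷ _ , _} _ = refl

  applySNPR-liftʳ : ∀ {a b : BT A} {θ} → IsSNPR b θ → applySNPR (node a b) (liftOp R θ) ≡ node a (applySNPR b θ)
  applySNPR-liftʳ {θ = [] , _} (_ , _ , e≢[] , _) = ⊥-elim (e≢[] refl)
  applySNPR-liftʳ {θ = _ ∷ _ , _} _ = refl

  mkIsSNPR : ∀ {t : BT A} {d e f} → Valid t (d ∷ e) → Valid t f → ¬ ((d ∷ e) ≼ f) → IsSNPR t (d ∷ e , f)
  mkIsSNPR ve vf e⋠f = ve , vf , (λ ()) , e⋠f

  triangle-snpr : ∀ {T : BT A} σ → IsNNI T σ → All (IsSNPR T) (triangle σ)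
  triangle-snpr ([] , L , L) (goL (goL here)) =
    mkIsSNPR (goL (goR here)) here (λ ()) ∷ mkIsSNPR (goL (goL here)) (goR here) (λ ()) ∷
    mkIsSNPR (goR here) (goL (goL here)) (λ ()) ∷ []
  triangle-snpr ([] , L , R) (goL (goR here)) =
    mkIsSNPR (goL (goL here)) here (λ ()) ∷ mkIsSNPR (goL (goR here)) (goR here) (λ ()) ∷
    mkIsSNPR (goR here) (goL (goR here)) (λ ()) ∷ []
  triangle-snpr ([] , R , L) (goR (goL here)) =
    mkIsSNPR (goR (goR here)) here (λ ()) ∷ mkIsSNPR (goR (goL here)) (goL here) (λ ()) ∷
    mkIsSNPR (goL here) (goR (goL here)) (λ ()) ∷ []
  triangle-snpr ([] , R , R) (goR (goR here)) =
    mkIsSNPR (goR (goL here)) here (λ ()) ∷ mkIsSNPR (goR (goR here)) (goL here) (λ ()) ∷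
    mkIsSNPR (goL here) (goR (goR here)) (λ ()) ∷ []
  triangle-snpr (L ∷ q , c , d) (goL v) = All-map⁺ {f = liftOp L} (All.map snpr-liftˡ (triangle-snpr (q , c , d) v))
  triangle-snpr (R ∷ q , c , d) (goR v) = All-map⁺ {f = liftOp R} (All.map snpr-liftʳ (triangle-snpr (q , c , d) v))

  nni-snpr : ∀ {T : BT A} σ → IsNNI T σ → IsSNPR T (nniOp σ)
  nni-snpr σ v = lookup (triangle-snpr σ v) (there (here refl))

  triangle-≅ : ∀ {T : BT A} σ → IsNNI T σ → All (λ θ → applySNPR T θ ≅ applyNNI T σ) (triangle σ)
  triangle-≅ ([] , L , L) (goL (goL here)) = swap (swap ≅-refl ≅-refl) ≅-refl ∷ ≅-refl ∷ swap (swap ≅-refl ≅-refl) ≅-refl ∷ []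
  triangle-≅ ([] , L , R) (goL (goR here)) = swap (swap ≅-refl ≅-refl) ≅-refl ∷ ≅-refl ∷ node ≅-refl (swap ≅-refl ≅-refl) ∷ []
  triangle-≅ ([] , R , L) (goR (goL here)) = ≅-refl ∷ ≅-refl ∷ node (swap ≅-refl ≅-refl) ≅-refl ∷ []
  triangle-≅ ([] , R , R) (goR (goR here)) = ≅-refl ∷ ≅-refl ∷ swap ≅-refl (swap ≅-refl ≅-refl) ∷ []
  triangle-≅ {node a b} (L ∷ q , c , d) (goL v) =
    All-map⁺ {f = liftOp L} (All.zipWith lift (triangle-snpr (q , c , d) v , triangle-≅ (q , c , d) v))
    where
      lift : ∀ {θ} → IsSNPR a θ × applySNPR a θ ≅ applyNNI a (q , c , d) →
        applySNPR (node a b) (liftOp L θ) ≅ applyNNI (node a b) (L ∷ q , c , d)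
      lift (s , h) = subst₂ _≅_ (sym (applySNPR-liftˡ s)) (sym (applySNPR-liftˡ (nni-snpr (q , c , d) v))) (node h ≅-refl)
  triangle-≅ {node a b} (R ∷ q , c , d) (goR v) =
    All-map⁺ {f = liftOp R} (All.zipWith lift (triangle-snpr (q , c , d) v , triangle-≅ (q , c , d) v))
    where
      lift : ∀ {θ} → IsSNPR b θ × applySNPR b θ ≅ applyNNI b (q , c , d) →
        applySNPR (node a b) (liftOp R θ) ≅ applyNNI (node a b) (R ∷ q , c , d)
      lift (s , h) = subst₂ _≅_ (sym (applySNPR-liftʳ s)) (sym (applySNPR-liftʳ (nni-snpr (q , c , d) v))) (node ≅-refl h)

-- Mirror symmetry

mirrorPath : Path → Path
mirrorPath = map flip

mirrorOp : Op → Op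
mirrorOp (e , f) = mirrorPath e , mirrorPath f

mirrorNNI : NNIData → NNIData
mirrorNNI (q , c , d) = mirrorPath q , flip c , flip d

flip-involutive : ∀ d → flip (flip d) ≡ d
flip-involutive L = refl
flip-involutive R = refl

mirrorPath-involutive : ∀ p → mirrorPath (mirrorPath p) ≡ p
mirrorPath-involutive [] = refl
mirrorPath-involutive (d ∷ p) = cong₂ _∷_ (flip-involutive d) (mirrorPath-involutive p)

mirrorOp-involutive : ∀ θ → mirrorOp (mirrorOp θ) ≡ θ
mirrorOp-involutive (e , f) = cong₂ _,_ (mirrorPath-involutive e) (mirrorPath-involutive f)

mirrorOp-injective : ∀ {θ θ'} → mirrorOp θ ≡ mirrorOp θ' → θ ≡ θ'
mirrorOp-injective {θ} {θ'} eq =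
  trans (sym (mirrorOp-involutive θ)) (trans (cong mirrorOp eq) (mirrorOp-involutive θ'))

mirrorPath-≡[] : ∀ {e} → mirrorPath e ≡ [] → e ≡ []
mirrorPath-≡[] {[]} _ = refl

mirrorPath-≼ : ∀ {e f} → mirrorPath e ≼ mirrorPath f → e ≼ f
mirrorPath-≼ {[]} _ = nil
mirrorPath-≼ {L ∷ e} {L ∷ f} (cons p) = cons (mirrorPath-≼ p)
mirrorPath-≼ {R ∷ e} {R ∷ f} (cons p) = cons (mirrorPath-≼ p)

mirrorPath-mapPos : ∀ e f → mirrorPath (mapPos e f) ≡ mapPos (mirrorPath e) (mirrorPath f)
mirrorPath-mapPos [] f = refl
mirrorPath-mapPos (L ∷ []) [] = refl
mirrorPath-mapPos (R ∷ []) [] = refl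
mirrorPath-mapPos (L ∷ []) (L ∷ f) = refl
mirrorPath-mapPos (L ∷ []) (R ∷ f) = refl
mirrorPath-mapPos (R ∷ []) (L ∷ f) = refl
mirrorPath-mapPos (R ∷ []) (R ∷ f) = refl
mirrorPath-mapPos (L ∷ _ ∷ _) [] = refl
mirrorPath-mapPos (R ∷ _ ∷ _) [] = refl
mirrorPath-mapPos (L ∷ d ∷ e) (L ∷ f) = cong (R ∷_) (mirrorPath-mapPos (d ∷ e) f)
mirrorPath-mapPos (L ∷ d ∷ e) (R ∷ f) = refl
mirrorPath-mapPos (R ∷ d ∷ e) (L ∷ f) = refl
mirrorPath-mapPos (R ∷ d ∷ e) (R ∷ f) = cong (L ∷_) (mirrorPath-mapPos (d ∷ e) f)

mirror-triangle : ∀ σ → map mirrorOp (triangle σ) ≡ triangle (mirrorNNI σ)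
mirror-triangle (q , c , d)
  rewrite map-++ flip q (c ∷ flip d ∷ []) | map-++ flip q (c ∷ d ∷ []) | map-++ flip q (flip c ∷ []) = refl

module _ {A : Set} where

  mirror : BT A → BT A
  mirror (leaf x) = leaf x
  mirror (node a b) = node (mirror b) (mirror a)

  mirror-involutive : ∀ t → mirror (mirror t) ≡ t
  mirror-involutive (leaf x) = refl
  mirror-involutive (node a b) = cong₂ node (mirror-involutive a) (mirror-involutive b)

  mirror-sub : ∀ t e → mirror (sub t e) ≡ sub (mirror t) (mirrorPath e)
  mirror-sub t [] = refl
  mirror-sub (leaf x) (_ ∷ _) = refl
  mirror-sub (node a b) (L ∷ e) = mirror-sub a e
  mirror-sub (node a b) (R ∷ e) = mirror-sub b e

  mirror-prune : ∀ t e → mirror (pruneAt t e) ≡ pruneAt (mirror t) (mirrorPath e)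
  mirror-prune (leaf x) [] = refl
  mirror-prune (leaf x) (_ ∷ _) = refl
  mirror-prune (node a b) [] = refl
  mirror-prune (node a b) (L ∷ []) = refl
  mirror-prune (node a b) (R ∷ []) = refl
  mirror-prune (node a b) (L ∷ d ∷ e) = cong (node (mirror b)) (mirror-prune a (d ∷ e))
  mirror-prune (node a b) (R ∷ d ∷ e) = cong (λ u → node u (mirror a)) (mirror-prune b (d ∷ e))

  mirror-≅ : ∀ {s t : BT A} → s ≅ t → mirror s ≅ mirror t
  mirror-≅ leaf = leaf
  mirror-≅ (node p q) = node (mirror-≅ q) (mirror-≅ p)
  mirror-≅ (swap p q) = swap (mirror-≅ q) (mirror-≅ p)

  mirror-graft : ∀ s r x → mirror (graft s r x) ≅ graft (mirror s) (mirrorPath r) (mirror x)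
  mirror-graft s [] x = swap ≅-refl ≅-refl
  mirror-graft (leaf y) (_ ∷ r) x = swap ≅-refl ≅-refl
  mirror-graft (node a b) (L ∷ r) x = node ≅-refl (mirror-graft a r x)
  mirror-graft (node a b) (R ∷ r) x = node (mirror-graft b r x) ≅-refl

  mirror-applySNPR : ∀ t θ → mirror (applySNPR t θ) ≅ applySNPR (mirror t) (mirrorOp θ)
  mirror-applySNPR t (e , f)
    rewrite sym (mirror-prune t e) | sym (mirror-sub t e) | sym (mirrorPath-mapPos e f) =
    mirror-graft (pruneAt t e) (mapPos e f) (sub t e)

  mirror-valid : ∀ {t : BT A} {e} → Valid t e → Valid (mirror t) (mirrorPath e)
  mirror-valid here = here
  mirror-valid (goL v) = goR (mirror-valid v)
  mirror-valid (goR v) = goL (mirror-valid v)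

  ∈-mirror⁻ : ∀ {t z} → z ∈ₜ mirror t → z ∈ₜ t
  ∈-mirror⁻ {leaf x} m = m
  ∈-mirror⁻ {node a b} (inL m) = inR (∈-mirror⁻ m)
  ∈-mirror⁻ {node a b} (inR m) = inL (∈-mirror⁻ m)

  mirror-distinct : ∀ t → Distinct t → Distinct (mirror t)
  mirror-distinct (leaf x) _ = _
  mirror-distinct (node a b) (Dᵃ , Dᵇ , D) =
    mirror-distinct b Dᵇ , mirror-distinct a Dᵃ , λ m k → D (∈-mirror⁻ k) (∈-mirror⁻ m)

  mirror-snpr : ∀ {t : BT A} {θ} → IsSNPR t θ → IsSNPR (mirror t) (mirrorOp θ)
  mirror-snpr (ve , vf , e≢[] , e⋠f) =
    mirror-valid ve , mirror-valid vf , (λ eq → e≢[] (mirrorPath-≡[] eq)) , (λ p → e⋠f (mirrorPath-≼ p))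

  mirror-nni : ∀ {t : BT A} σ → IsNNI t σ → IsNNI (mirror t) (mirrorNNI σ)
  mirror-nni (q , c , d) v = subst (Valid _) (map-++ flip q (c ∷ d ∷ [])) (mirror-valid v)

-- Redundant pairs lie in a common triangle

module _ {A : Set} where

  Redundant : BT A → Op → Op → Set
  Redundant T θ θ' = θ ≢ θ' × applySNPR T θ ≅ applySNPR T θ' × ¬ (applySNPR T θ ≅ T)

  Redundant-sym : ∀ {T θ θ'} → Redundant T θ θ' → Redundant T θ' θ
  Redundant-sym (θ≢θ' , h , nT) = (λ eq → θ≢θ' (sym eq)) , ≅-sym h , (λ k → nT (≅-trans h k))

  SameTriangle : BT A → Op → Op → Set
  SameTriangle T θ θ' = Σ NNIData λ σ → IsNNI T σ × θ ∈ triangle σ × θ' ∈ triangle σ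

  SameTriangle-sym : ∀ {T θ θ'} → SameTriangle T θ θ' → SameTriangle T θ' θ
  SameTriangle-sym (σ , v , m , m') = σ , v , m' , m

  RedundancyIsTriangular : BT A → Set
  RedundancyIsTriangular T =
    Distinct T → ∀ {θ θ'} → IsSNPR T θ → IsSNPR T θ' → Redundant T θ θ' → SameTriangle T θ θ'

  mirror-redundant : ∀ {T θ θ'} → Redundant T θ θ' → Redundant (mirror T) (mirrorOp θ) (mirrorOp θ')
  mirror-redundant {T} {θ} {θ'} (θ≢θ' , h , nT) =
    (λ eq → θ≢θ' (mirrorOp-injective eq)) ,
    ≅-trans (≅-sym (mirror-applySNPR T θ)) (≅-trans (mirror-≅ h) (mirror-applySNPR T θ')) ,
    λ k → nT (subst₂ _≅_ (mirror-involutive _) (mirror-involutive T)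
                (mirror-≅ (≅-trans (mirror-applySNPR T θ) k)))

  sameTriangle-mirror⁻ : ∀ {T θ θ'} → SameTriangle (mirror T) (mirrorOp θ) (mirrorOp θ') → SameTriangle T θ θ'
  sameTriangle-mirror⁻ {T} (σ , v , m , m') =
    mirrorNNI σ , subst (λ t → IsNNI t (mirrorNNI σ)) (mirror-involutive T) (mirror-nni σ v) , back m , back m'
    where
      back : ∀ {θ} → mirrorOp θ ∈ triangle σ → θ ∈ triangle (mirrorNNI σ)
      back {θ} k = subst₂ _∈_ (mirrorOp-involutive θ) (mirror-triangle σ) (∈-map⁺ mirrorOp k)

  redundancyIsTriangular-mirror⁻ : ∀ {T} → RedundancyIsTriangular (mirror T) → RedundancyIsTriangular T
  redundancyIsTriangular-mirror⁻ {T} rit D s s' red =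
    sameTriangle-mirror⁻ (rit (mirror-distinct T D) (mirror-snpr s) (mirror-snpr s') (mirror-redundant red))

  -- x↝y: the pruned subtree is x (a side of the root, or a proper subtree of it when written inX)
  -- and it is regrafted into y.
  data TopMove : BT A → Op → Set where
    a↝b₁ : ∀ {a b₁ b₂ s} → Valid b₁ s → TopMove (node a (node b₁ b₂)) (L ∷ [] , R ∷ L ∷ s)
    a↝b₂ : ∀ {a b₁ b₂ s} → Valid b₂ s → TopMove (node a (node b₁ b₂)) (L ∷ [] , R ∷ R ∷ s)
    inA↝root : ∀ {a b d p} → Valid a (d ∷ p) → TopMove (node a b) (L ∷ d ∷ p , [])
    inA↝inA : ∀ {a b d p r} → Valid a (d ∷ p) → Valid a r → ¬ ((d ∷ p) ≼ r) → TopMove (node a b) (L ∷ d ∷ p , L ∷ r)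
    inA↝b : ∀ {a b d p r} → Valid a (d ∷ p) → Valid b r → TopMove (node a b) (L ∷ d ∷ p , R ∷ r)
    b↝a₁ : ∀ {a₁ a₂ b s} → Valid a₁ s → TopMove (node (node a₁ a₂) b) (R ∷ [] , L ∷ L ∷ s)
    b↝a₂ : ∀ {a₁ a₂ b s} → Valid a₂ s → TopMove (node (node a₁ a₂) b) (R ∷ [] , L ∷ R ∷ s)
    inB↝root : ∀ {a b d p} → Valid b (d ∷ p) → TopMove (node a b) (R ∷ d ∷ p , [])
    inB↝inB : ∀ {a b d p r} → Valid b (d ∷ p) → Valid b r → ¬ ((d ∷ p) ≼ r) → TopMove (node a b) (R ∷ d ∷ p , R ∷ r)
    inB↝a : ∀ {a b d p r} → Valid b (d ∷ p) → Valid a r → TopMove (node a b) (R ∷ d ∷ p , L ∷ r)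

  topMove : ∀ {T : BT A} {θ} → IsSNPR T θ → applySNPR T θ ≅ T ⊎ TopMove T θ
  topMove {θ = [] , _} (_ , _ , e≢[] , _) = ⊥-elim (e≢[] refl)
  topMove {node a b} {L ∷ [] , []} _ = inj₁ (swap ≅-refl ≅-refl)
  topMove {node a b} {L ∷ [] , L ∷ _} (_ , _ , _ , e⋠f) = ⊥-elim (e⋠f (cons nil))
  topMove {node a b} {L ∷ [] , R ∷ []} _ = inj₁ (swap ≅-refl ≅-refl)
  topMove {node a (node b₁ b₂)} {L ∷ [] , R ∷ L ∷ _} (_ , goR (goL v) , _) = inj₂ (a↝b₁ v)
  topMove {node a (node b₁ b₂)} {L ∷ [] , R ∷ R ∷ _} (_ , goR (goR v) , _) = inj₂ (a↝b₂ v)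
  topMove {node a b} {L ∷ _ ∷ _ , []} (goL v , _) = inj₂ (inA↝root v)
  topMove {node a b} {L ∷ _ ∷ _ , L ∷ _} (goL v , goL w , _ , e⋠f) = inj₂ (inA↝inA v w (λ k → e⋠f (cons k)))
  topMove {node a b} {L ∷ _ ∷ _ , R ∷ _} (goL v , goR w , _) = inj₂ (inA↝b v w)
  topMove {node a b} {R ∷ [] , []} _ = inj₁ ≅-refl
  topMove {node a b} {R ∷ [] , R ∷ _} (_ , _ , _ , e⋠f) = ⊥-elim (e⋠f (cons nil))
  topMove {node a b} {R ∷ [] , L ∷ []} _ = inj₁ ≅-refl
  topMove {node (node a₁ a₂) b} {R ∷ [] , L ∷ L ∷ _} (_ , goL (goL v) , _) = inj₂ (b↝a₁ v)
  topMove {node (node a₁ a₂) b} {R ∷ [] , L ∷ R ∷ _} (_ , goL (goR v) , _) = inj₂ (b↝a₂ v)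
  topMove {node a b} {R ∷ _ ∷ _ , []} (goR v , _) = inj₂ (inB↝root v)
  topMove {node a b} {R ∷ _ ∷ _ , R ∷ _} (goR v , goR w , _ , e⋠f) = inj₂ (inB↝inB v w (λ k → e⋠f (cons k)))
  topMove {node a b} {R ∷ _ ∷ _ , L ∷ _} (goR v , goL w , _) = inj₂ (inB↝a v w)

  sameTriangle-a↝b₁ : ∀ {a b₁ b₂ s θ'} → let T = node a (node b₁ b₂) ; θ = (L ∷ [] , R ∷ L ∷ s) in
    Distinct T → Valid b₁ s → TopMove T θ' → Redundant T θ θ' → SameTriangle T θ θ'
  sameTriangle-a↝b₁ {a} {_} {_} {s} (_ , (D₁ , _ , _) , Dᵃᵇ) vs (a↝b₁ vs') (θ≢θ' , h , _) with node-≅⁻ h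
  ... | inj₁ (h₁ , _) = ⊥-elim (θ≢θ' (cong (λ u → (L ∷ [] , R ∷ L ∷ u)) (graft-position-injective D₁ (λ m k → Dᵃᵇ k (inL m)) vs vs' h₁)))
  ... | inj₂ (h₁ , _) = ⊥-elim (≇-by-leaf (∈-graft⁺ʳ s (leftmost∈ a)) (λ m → Dᵃᵇ (leftmost∈ a) (inR m)) h₁)
  sameTriangle-a↝b₁ {a} {b₁} {_} {s} (_ , (_ , _ , D₁₂) , Dᵃᵇ) _ (a↝b₂ {s = s'} _) (_ , h , _) = contradiction h (node-≇
    (λ (h₁ , _) → ≇-by-leaf (∈-graft⁺ʳ s (leftmost∈ a)) (λ m → Dᵃᵇ (leftmost∈ a) (inL m)) h₁)
    (λ (h₁ , _) → ≇-by-leaf (∈-graft⁺ˡ s (leftmost∈ b₁)) (∉-graft s' (λ m → D₁₂ (leftmost∈ b₁) m) (λ m → Dᵃᵇ m (inL (leftmost∈ b₁)))) h₁))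
  sameTriangle-a↝b₁ {a} {_} {b₂} {_} (_ , _ , Dᵃᵇ) _ (inA↝root {d = d'} {p = p'} _) (_ , h , _) = contradiction h (node-≇
    (λ (_ , h₂) → ≇-by-leaf (leftmost∈ b₂) (λ m → Dᵃᵇ (∈-sub⁻ (d' ∷ p') m) (inR (leftmost∈ b₂))) h₂)
    (λ (_ , h₂) → ≇-by-leaf′ (λ m → Dᵃᵇ (∈-prune⁻ (d' ∷ p') (leftmost∈ (pruneAt a (d' ∷ p')))) (inR m)) (inL (leftmost∈ (pruneAt a (d' ∷ p')))) h₂))
  sameTriangle-a↝b₁ {_} {b₁} {b₂} {_} (_ , (_ , _ , D₁₂) , Dᵃᵇ) _ (inA↝inA {d = d'} {p = p'} {r = r'} _ _ _) (_ , h , _) = contradiction h (node-≇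
    (λ (_ , h₂) → ≇-by-leaf′ (λ m → D₁₂ (leftmost∈ b₁) m) (inL (leftmost∈ b₁)) h₂)
    (λ (_ , h₂) → ≇-by-leaf (leftmost∈ b₂) (λ m → Dᵃᵇ (∈-snpr⁻ (d' ∷ p' , r') m) (inR (leftmost∈ b₂))) h₂))
  sameTriangle-a↝b₁ {_} {b₁} {b₂} {_} (_ , (_ , _ , D₁₂) , Dᵃᵇ) _ (inA↝b {d = d'} {p = p'} {r = r'} _ _) (_ , h , _) = contradiction h (node-≇
    (λ (_ , h₂) → ≇-by-leaf′ (λ m → D₁₂ (leftmost∈ b₁) m) (∈-graft⁺ˡ r' (inL (leftmost∈ b₁))) h₂)
    (λ (_ , h₂) → ≇-by-leaf (leftmost∈ b₂) (λ m → Dᵃᵇ (∈-prune⁻ (d' ∷ p') m) (inR (leftmost∈ b₂))) h₂))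
  sameTriangle-a↝b₁ {node a₁ _} {_} {b₂} {_} (_ , _ , Dᵃᵇ) _ (b↝a₁ {s = s'} _) (_ , h , _) = contradiction h (node-≇
    (λ (_ , h₂) → ≇-by-leaf (leftmost∈ b₂) (λ m → Dᵃᵇ (inR m) (inR (leftmost∈ b₂))) h₂)
    (λ (_ , h₂) → ≇-by-leaf′ (λ m → Dᵃᵇ (inL (leftmost∈ a₁)) (inR m)) (∈-graft⁺ˡ s' (leftmost∈ a₁)) h₂))
  sameTriangle-a↝b₁ {node _ a₂} {_} {b₂} {_} (_ , _ , Dᵃᵇ) _ (b↝a₂ {s = s'} _) (_ , h , _) = contradiction h (node-≇
    (λ (_ , h₂) → ≇-by-leaf′ (λ m → Dᵃᵇ (inR (leftmost∈ a₂)) (inR m)) (∈-graft⁺ˡ s' (leftmost∈ a₂)) h₂)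
    (λ (_ , h₂) → ≇-by-leaf (leftmost∈ b₂) (λ m → Dᵃᵇ (inL m) (inR (leftmost∈ b₂))) h₂))
  sameTriangle-a↝b₁ {a} (_ , (D₁ , D₂ , D₁₂) , Dᵃᵇ) vs (inB↝root vq') (_ , h , _) with node-≅⁻ h
  ... | inj₂ (_ , h₂) = ⊥-elim (≇-by-leaf′ (λ m → Dᵃᵇ (leftmost∈ a) (inR m)) (inL (leftmost∈ a)) h₂)
  ... | inj₁ (h₁ , h₂) with sub-≅⇒≡ (D₁ , D₂ , D₁₂) (goR here) vq' h₂
  ... | refl with graft-position-injective D₁ (λ m k → Dᵃᵇ k (inL m)) vs here (≅-trans h₁ (swap ≅-refl ≅-refl))
  ... | refl = ([] , R , L) , goR (goL here) , there (there (here refl)) , here refl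
  sameTriangle-a↝b₁ {_} {b₁} {b₂} {_} (_ , (_ , _ , D₁₂) , Dᵃᵇ) _ (inB↝inB {r = r'} vq' _ _) (_ , h , _) = contradiction h (node-≇
    (λ (_ , h₂) → ≇-by-leaf′ (λ m → D₁₂ (leftmost∈ b₁) m) (∈-snpr⁺ r' vq' (inL (leftmost∈ b₁))) h₂)
    (λ (_ , h₂) → ≇-by-leaf (leftmost∈ b₂) (λ m → Dᵃᵇ m (inR (leftmost∈ b₂))) h₂))
  sameTriangle-a↝b₁ {a} (Dᵃ , (D₁ , D₂ , D₁₂) , Dᵃᵇ) vs (inB↝a {r = r'} vq' vr') (_ , h , _) with node-≅⁻ h
  ... | inj₂ (_ , h₂) = ⊥-elim (≇-by-leaf′ (λ m → Dᵃᵇ (leftmost∈ a) (inR m)) (∈-graft⁺ˡ r' (leftmost∈ a)) h₂)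
  ... | inj₁ (h₁ , h₂) with prune≅right⇒left (D₁ , D₂ , D₁₂) vq' h₂
  ... | refl with graft-exchange⇒root D₁ (λ m k → Dᵃᵇ k (inL m)) vs vr' h₁ | graft-exchange⇒root Dᵃ (λ m k → Dᵃᵇ m (inL k)) vr' vs (≅-sym h₁)
  ... | refl | refl = ([] , R , L) , goR (goL here) , there (there (here refl)) , there (here refl)

  sameTriangle-a↝b₂ : ∀ {a b₁ b₂ s θ'} → let T = node a (node b₁ b₂) ; θ = (L ∷ [] , R ∷ R ∷ s) in
    Distinct T → Valid b₂ s → TopMove T θ' → Redundant T θ θ' → SameTriangle T θ θ'
  sameTriangle-a↝b₂ {a} {b₁} (_ , (_ , _ , D₁₂) , Dᵃᵇ) _ (a↝b₁ {s = s'} _) (_ , h , _) = contradiction h (node-≇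
    (λ (h₁ , _) → ≇-by-leaf′ (λ m → Dᵃᵇ (leftmost∈ a) (inL m)) (∈-graft⁺ʳ s' (leftmost∈ a)) h₁)
    (λ (h₁ , _) → ≇-by-leaf (leftmost∈ b₁) (λ m → D₁₂ (leftmost∈ b₁) m) h₁))
  sameTriangle-a↝b₂ {a} (_ , (_ , D₂ , _) , Dᵃᵇ) vs (a↝b₂ {s = s'} vs') (θ≢θ' , h , _) with node-≅⁻ h
  ... | inj₁ (_ , h₂) = ⊥-elim (θ≢θ' (cong (λ u → (L ∷ [] , R ∷ R ∷ u)) (graft-position-injective D₂ (λ m k → Dᵃᵇ k (inR m)) vs vs' h₂)))
  ... | inj₂ (h₁ , _) = ⊥-elim (≇-by-leaf′ (λ m → Dᵃᵇ (leftmost∈ a) (inL m)) (∈-graft⁺ʳ s' (leftmost∈ a)) h₁)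
  sameTriangle-a↝b₂ {a} {b₁} (_ , _ , Dᵃᵇ) _ (inA↝root {d = d'} {p = p'} _) (_ , h , _) = contradiction h (node-≇
    (λ (h₁ , _) → ≇-by-leaf′ (λ m → Dᵃᵇ (∈-prune⁻ (d' ∷ p') (leftmost∈ (pruneAt a (d' ∷ p')))) (inL m)) (inL (leftmost∈ (pruneAt a (d' ∷ p')))) h₁)
    (λ (h₁ , _) → ≇-by-leaf (leftmost∈ b₁) (λ m → Dᵃᵇ (∈-sub⁻ (d' ∷ p') m) (inL (leftmost∈ b₁))) h₁))
  sameTriangle-a↝b₂ {_} {b₁} {b₂} {_} (_ , (_ , _ , D₁₂) , Dᵃᵇ) _ (inA↝inA {d = d'} {p = p'} {r = r'} _ _ _) (_ , h , _) = contradiction h (node-≇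
    (λ (h₁ , _) → ≇-by-leaf (leftmost∈ b₁) (λ m → Dᵃᵇ (∈-snpr⁻ (d' ∷ p' , r') m) (inL (leftmost∈ b₁))) h₁)
    (λ (h₁ , _) → ≇-by-leaf′ (λ m → D₁₂ m (leftmost∈ b₂)) (inR (leftmost∈ b₂)) h₁))
  sameTriangle-a↝b₂ {a} {b₁} (_ , _ , Dᵃᵇ) _ (inA↝b {d = d'} {p = p'} {r = r'} _ _) (_ , h , _) = contradiction h (node-≇
    (λ (h₁ , _) → ≇-by-leaf (leftmost∈ b₁) (λ m → Dᵃᵇ (∈-prune⁻ (d' ∷ p') m) (inL (leftmost∈ b₁))) h₁)
    (λ (h₁ , _) → ≇-by-leaf′ (λ m → Dᵃᵇ (∈-sub⁻ (d' ∷ p') (leftmost∈ (sub a (d' ∷ p')))) (inL m)) (∈-graft⁺ʳ r' (leftmost∈ (sub a (d' ∷ p')))) h₁))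
  sameTriangle-a↝b₂ {node a₁ _} {b₁} (_ , _ , Dᵃᵇ) _ (b↝a₁ {s = s'} _) (_ , h , _) = contradiction h (node-≇
    (λ (h₁ , _) → ≇-by-leaf′ (λ m → Dᵃᵇ (inL (leftmost∈ a₁)) (inL m)) (∈-graft⁺ˡ s' (leftmost∈ a₁)) h₁)
    (λ (h₁ , _) → ≇-by-leaf (leftmost∈ b₁) (λ m → Dᵃᵇ (inR m) (inL (leftmost∈ b₁))) h₁))
  sameTriangle-a↝b₂ {node _ a₂} {b₁} (_ , _ , Dᵃᵇ) _ (b↝a₂ {s = s'} _) (_ , h , _) = contradiction h (node-≇
    (λ (h₁ , _) → ≇-by-leaf (leftmost∈ b₁) (λ m → Dᵃᵇ (inL m) (inL (leftmost∈ b₁))) h₁)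
    (λ (h₁ , _) → ≇-by-leaf′ (λ m → Dᵃᵇ (inR (leftmost∈ a₂)) (inL m)) (∈-graft⁺ˡ s' (leftmost∈ a₂)) h₁))
  sameTriangle-a↝b₂ {a} (_ , (D₁ , D₂ , D₁₂) , Dᵃᵇ) vs (inB↝root vq') (_ , h , _) with node-≅⁻ h
  ... | inj₁ (h₁ , _) = ⊥-elim (≇-by-leaf′ (λ m → Dᵃᵇ (leftmost∈ a) (inL m)) (inL (leftmost∈ a)) h₁)
  ... | inj₂ (h₁ , h₂) with sub-≅⇒≡ (D₁ , D₂ , D₁₂) (goL here) vq' h₁
  ... | refl with graft-position-injective D₂ (λ m k → Dᵃᵇ k (inR m)) vs here (≅-trans h₂ (swap ≅-refl ≅-refl))
  ... | refl = ([] , R , R) , goR (goR here) , there (there (here refl)) , here refl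
  sameTriangle-a↝b₂ {_} {b₁} {b₂} {_} (_ , (_ , _ , D₁₂) , Dᵃᵇ) _ (inB↝inB {r = r'} vq' _ _) (_ , h , _) = contradiction h (node-≇
    (λ (h₁ , _) → ≇-by-leaf (leftmost∈ b₁) (λ m → Dᵃᵇ m (inL (leftmost∈ b₁))) h₁)
    (λ (h₁ , _) → ≇-by-leaf′ (λ m → D₁₂ m (leftmost∈ b₂)) (∈-snpr⁺ r' vq' (inR (leftmost∈ b₂))) h₁))
  sameTriangle-a↝b₂ {a} (Dᵃ , (D₁ , D₂ , D₁₂) , Dᵃᵇ) vs (inB↝a {r = r'} vq' vr') (_ , h , _) with node-≅⁻ h
  ... | inj₁ (h₁ , _) = ⊥-elim (≇-by-leaf′ (λ m → Dᵃᵇ (leftmost∈ a) (inL m)) (∈-graft⁺ˡ r' (leftmost∈ a)) h₁)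
  ... | inj₂ (h₁ , h₂) with prune≅left⇒right (D₁ , D₂ , D₁₂) vq' h₁
  ... | refl with graft-exchange⇒root D₂ (λ m k → Dᵃᵇ k (inR m)) vs vr' h₂ | graft-exchange⇒root Dᵃ (λ m k → Dᵃᵇ m (inR k)) vr' vs (≅-sym h₂)
  ... | refl | refl = ([] , R , R) , goR (goR here) , there (there (here refl)) , there (here refl)

  sameTriangle-inA↝root : ∀ {a b d p θ'} → let T = node a b ; θ = (L ∷ d ∷ p , []) in
    Distinct T → Valid a (d ∷ p) → TopMove T θ' → Redundant T θ θ' → SameTriangle T θ θ'
  sameTriangle-inA↝root D vq (a↝b₁ vs') red = SameTriangle-sym (sameTriangle-a↝b₁ D vs' (inA↝root vq) (Redundant-sym red))
  sameTriangle-inA↝root D vq (a↝b₂ vs') red = SameTriangle-sym (sameTriangle-a↝b₂ D vs' (inA↝root vq) (Redundant-sym red))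
  sameTriangle-inA↝root {_} {b} {_} {_} (Dᵃ , _ , Dᵃᵇ) vq (inA↝root {d = d'} {p = p'} vq') (θ≢θ' , h , _) with node-≅⁻ h
  ... | inj₁ (_ , h₂) = ⊥-elim (θ≢θ' (cong (λ u → (L ∷ u , [])) (sub-≅⇒≡ Dᵃ vq vq' h₂)))
  ... | inj₂ (h₁ , _) = ⊥-elim (≇-by-leaf (inR (leftmost∈ b)) (λ m → Dᵃᵇ (∈-sub⁻ (d' ∷ p') m) (leftmost∈ b)) h₁)
  sameTriangle-inA↝root {a} {b} {d} {p} (_ , _ , Dᵃᵇ) _ (inA↝inA {d = d'} {p = p'} {r = r'} _ _ _) (_ , h , _) = contradiction h (node-≇
    (λ (h₁ , _) → ≇-by-leaf (inR (leftmost∈ b)) (λ m → Dᵃᵇ (∈-snpr⁻ (d' ∷ p' , r') m) (leftmost∈ b)) h₁)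
    (λ (h₁ , _) → ≇-by-leaf (inL (leftmost∈ (pruneAt a (d ∷ p)))) (λ m → Dᵃᵇ (∈-prune⁻ (d ∷ p) (leftmost∈ (pruneAt a (d ∷ p)))) m) h₁))
  sameTriangle-inA↝root {_} {b} {d} {p} (Dᵃ , _ , Dᵃᵇ) vq (inA↝b {d = d'} {p = p'} vq' vr') (_ , h , _) with node-≅⁻ h
  ... | inj₁ (h₁ , _) = ⊥-elim (≇-by-leaf (inR (leftmost∈ b)) (λ m → Dᵃᵇ (∈-prune⁻ (d' ∷ p') m) (leftmost∈ b)) h₁)
  ... | inj₂ (h₁ , h₂) with node≅graft⇒root (λ m k → Dᵃᵇ (∈-prune⁻ (d ∷ p) m) k) vr' h₁
  ... | refl with sub≅prune⇒siblings Dᵃ vq vq' h₂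
  ... | inj₁ (refl , refl) = ([] , L , R) , goL vq' , here refl , there (here refl)
  ... | inj₂ (refl , refl) = ([] , L , L) , goL vq' , here refl , there (here refl)
  sameTriangle-inA↝root {node _ _} {b} {d} {p} (Dᵃ@(D₁ , _ , _) , _ , Dᵃᵇ) vq (b↝a₁ {s = s'} vs') (_ , h , _) with node-≅⁻ h
  ... | inj₂ (_ , h₂) = ⊥-elim (≇-by-leaf′ (λ m → Dᵃᵇ (∈-sub⁻ (d ∷ p) m) (leftmost∈ b)) (∈-graft⁺ʳ s' (leftmost∈ b)) h₂)
  ... | inj₁ (h₁ , h₂) with sub-≅⇒≡ Dᵃ vq (goR here) h₂
  ... | refl with graft-position-injective D₁ (λ m k → Dᵃᵇ (inL m) k) here vs' h₁
  ... | refl = ([] , L , L) , goL (goL here) , here refl , there (there (here refl))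
  sameTriangle-inA↝root {node _ _} {b} (Dᵃ@(_ , D₂ , _) , _ , Dᵃᵇ) vq (b↝a₂ vs') (_ , h , _) with node-≅⁻ h
  ... | inj₁ (h₁ , _) = ⊥-elim (≇-by-leaf (inR (leftmost∈ b)) (λ m → Dᵃᵇ (inL m) (leftmost∈ b)) h₁)
  ... | inj₂ (h₁ , h₂) with sub-≅⇒≡ Dᵃ vq (goL here) h₂
  ... | refl with graft-position-injective D₂ (λ m k → Dᵃᵇ (inR m) k) here vs' h₁
  ... | refl = ([] , L , R) , goL (goR here) , here refl , there (there (here refl))
  sameTriangle-inA↝root {a} {b} {d} {p} (_ , _ , Dᵃᵇ) _ (inB↝root {d = d'} {p = p'} _) (_ , h , _) = contradiction h (node-≇
    (λ (_ , h₂) → ≇-by-leaf (leftmost∈ (sub a (d ∷ p))) (λ m → Dᵃᵇ (∈-sub⁻ (d ∷ p) (leftmost∈ (sub a (d ∷ p)))) (∈-sub⁻ (d' ∷ p') m)) h₂)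
    (λ (_ , h₂) → ≇-by-leaf′ (λ m → Dᵃᵇ (∈-sub⁻ (d ∷ p) m) (∈-prune⁻ (d' ∷ p') (leftmost∈ (pruneAt b (d' ∷ p'))))) (inR (leftmost∈ (pruneAt b (d' ∷ p')))) h₂))
  sameTriangle-inA↝root {a} {b} {d} {p} (_ , _ , Dᵃᵇ) _ (inB↝inB {d = d'} {p = p'} {r = r'} _ _ _) (_ , h , _) = contradiction h (node-≇
    (λ (h₁ , _) → ≇-by-leaf (inR (leftmost∈ b)) (λ m → Dᵃᵇ m (leftmost∈ b)) h₁)
    (λ (h₁ , _) → ≇-by-leaf (inL (leftmost∈ (pruneAt a (d ∷ p)))) (λ m → Dᵃᵇ (∈-prune⁻ (d ∷ p) (leftmost∈ (pruneAt a (d ∷ p)))) (∈-snpr⁻ (d' ∷ p' , r') m)) h₁))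
  sameTriangle-inA↝root {a} {b} {d} {p} (_ , _ , Dᵃᵇ) _ (inB↝a {d = d'} {p = p'} {r = r'} _ _) (_ , h , _) = contradiction h (node-≇
    (λ (_ , h₂) → ≇-by-leaf (leftmost∈ (sub a (d ∷ p))) (λ m → Dᵃᵇ (∈-sub⁻ (d ∷ p) (leftmost∈ (sub a (d ∷ p)))) (∈-prune⁻ (d' ∷ p') m)) h₂)
    (λ (_ , h₂) → ≇-by-leaf′ (λ m → Dᵃᵇ (∈-sub⁻ (d ∷ p) m) (∈-sub⁻ (d' ∷ p') (leftmost∈ (sub b (d' ∷ p'))))) (∈-graft⁺ʳ r' (leftmost∈ (sub b (d' ∷ p')))) h₂))

  sameTriangle-inA↝b : ∀ {a b d p r θ'} → let T = node a b ; θ = (L ∷ d ∷ p , R ∷ r) in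
    Distinct T → Valid a (d ∷ p) → Valid b r → TopMove T θ' → Redundant T θ θ' → SameTriangle T θ θ'
  sameTriangle-inA↝b D vq vr (a↝b₁ vs') red = SameTriangle-sym (sameTriangle-a↝b₁ D vs' (inA↝b vq vr) (Redundant-sym red))
  sameTriangle-inA↝b D vq vr (a↝b₂ vs') red = SameTriangle-sym (sameTriangle-a↝b₂ D vs' (inA↝b vq vr) (Redundant-sym red))
  sameTriangle-inA↝b D vq vr (inA↝root vq') red = SameTriangle-sym (sameTriangle-inA↝root D vq' (inA↝b vq vr) (Redundant-sym red))
  sameTriangle-inA↝b {a} {_} {d} {p} {_} (Dᵃ , _ , Dᵃᵇ) vq _ (inA↝inA {r = r'} vq' _ _) (_ , h , _) = contradiction h (node-≇
    (λ (h₁ , _) → ≇-by-leaf′ (λ m → sub-prune-disjoint Dᵃ vq (leftmost∈ (sub a (d ∷ p))) m) (∈-snpr⁺ r' vq' (∈-sub⁻ (d ∷ p) (leftmost∈ (sub a (d ∷ p))))) h₁)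
    (λ (h₁ , _) → ≇-by-leaf (leftmost∈ (pruneAt a (d ∷ p))) (λ m → Dᵃᵇ (∈-prune⁻ (d ∷ p) (leftmost∈ (pruneAt a (d ∷ p)))) m) h₁))
  sameTriangle-inA↝b {_} {b} {d} {p} {_} (Dᵃ , Dᵇ , Dᵃᵇ) vq vr (inA↝b {d = d'} {p = p'} {r = r'} vq' vr') (θ≢θ' , h , _) with node-≅⁻ h
  ... | inj₂ (h₁ , _) = ⊥-elim (≇-by-leaf′ (λ m → Dᵃᵇ (∈-prune⁻ (d ∷ p) m) (leftmost∈ b)) (∈-graft⁺ˡ r' (leftmost∈ b)) h₁)
  ... | inj₁ (_ , h₂) with sub-injective Dᵃ vq vq'
                              (graft-≅-scion⊆ (λ m k → Dᵃᵇ (∈-sub⁻ (d ∷ p) m) k) h₂)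
                              (graft-≅-scion⊆ (λ m k → Dᵃᵇ (∈-sub⁻ (d' ∷ p') m) k) (≅-sym h₂))
  ... | refl with graft-position-injective Dᵇ (λ m k → Dᵃᵇ (∈-sub⁻ (d ∷ p) k) m) vr vr' h₂
  ... | refl = ⊥-elim (θ≢θ' refl)
  sameTriangle-inA↝b {node _ _} {b} {d} {p} (Dᵃ@(D₁ , _ , _) , Dᵇ , Dᵃᵇ) vq vr (b↝a₁ {s = s'} vs') (_ , h , _) with node-≅⁻ h
  ... | inj₁ (h₁ , _) = ⊥-elim (≇-by-leaf′ (λ m → Dᵃᵇ (∈-prune⁻ (d ∷ p) m) (leftmost∈ b)) (∈-graft⁺ʳ s' (leftmost∈ b)) h₁)
  ... | inj₂ (h₁ , h₂) with prune≅right⇒left Dᵃ vq (≅-sym h₁)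
  ... | refl with graft-exchange⇒root Dᵇ (λ m k → Dᵃᵇ (inL k) m) vr vs' h₂ | graft-exchange⇒root D₁ (λ m k → Dᵃᵇ (inL m) k) vs' vr (≅-sym h₂)
  ... | refl | refl = ([] , L , L) , goL (goL here) , there (here refl) , there (there (here refl))
  sameTriangle-inA↝b {node _ _} {b} {d} {p} (Dᵃ@(_ , D₂ , _) , Dᵇ , Dᵃᵇ) vq vr (b↝a₂ {s = s'} vs') (_ , h , _) with node-≅⁻ h
  ... | inj₂ (h₁ , _) = ⊥-elim (≇-by-leaf′ (λ m → Dᵃᵇ (∈-prune⁻ (d ∷ p) m) (leftmost∈ b)) (∈-graft⁺ʳ s' (leftmost∈ b)) h₁)
  ... | inj₁ (h₁ , h₂) with prune≅left⇒right Dᵃ vq (≅-sym h₁)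
  ... | refl with graft-exchange⇒root Dᵇ (λ m k → Dᵃᵇ (inR k) m) vr vs' h₂ | graft-exchange⇒root D₂ (λ m k → Dᵃᵇ (inR m) k) vs' vr (≅-sym h₂)
  ... | refl | refl = ([] , L , R) , goL (goR here) , there (here refl) , there (there (here refl))
  sameTriangle-inA↝b {a} {_} {d} {p} {_} (Dᵃ , _ , Dᵃᵇ) vq _ (inB↝root {d = d'} {p = p'} _) (_ , h , _) = contradiction h (node-≇
    (λ (h₁ , _) → ≇-by-leaf′ (λ m → sub-prune-disjoint Dᵃ vq (leftmost∈ (sub a (d ∷ p))) m) (inL (∈-sub⁻ (d ∷ p) (leftmost∈ (sub a (d ∷ p))))) h₁)
    (λ (h₁ , _) → ≇-by-leaf (leftmost∈ (pruneAt a (d ∷ p))) (λ m → Dᵃᵇ (∈-prune⁻ (d ∷ p) (leftmost∈ (pruneAt a (d ∷ p)))) (∈-sub⁻ (d' ∷ p') m)) h₁))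
  sameTriangle-inA↝b {a} {_} {d} {p} {_} (Dᵃ , _ , Dᵃᵇ) vq _ (inB↝inB {d = d'} {p = p'} {r = r'} _ _ _) (_ , h , _) = contradiction h (node-≇
    (λ (h₁ , _) → ≇-by-leaf′ (λ m → sub-prune-disjoint Dᵃ vq (leftmost∈ (sub a (d ∷ p))) m) (∈-sub⁻ (d ∷ p) (leftmost∈ (sub a (d ∷ p)))) h₁)
    (λ (h₁ , _) → ≇-by-leaf (leftmost∈ (pruneAt a (d ∷ p))) (λ m → Dᵃᵇ (∈-prune⁻ (d ∷ p) (leftmost∈ (pruneAt a (d ∷ p)))) (∈-snpr⁻ (d' ∷ p' , r') m)) h₁))
  sameTriangle-inA↝b {a} {_} {d} {p} {_} (Dᵃ , _ , Dᵃᵇ) vq _ (inB↝a {d = d'} {p = p'} {r = r'} _ _) (_ , h , _) = contradiction h (node-≇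
    (λ (h₁ , _) → ≇-by-leaf′ (λ m → sub-prune-disjoint Dᵃ vq (leftmost∈ (sub a (d ∷ p))) m) (∈-graft⁺ˡ r' (∈-sub⁻ (d ∷ p) (leftmost∈ (sub a (d ∷ p))))) h₁)
    (λ (h₁ , _) → ≇-by-leaf (leftmost∈ (pruneAt a (d ∷ p))) (λ m → Dᵃᵇ (∈-prune⁻ (d ∷ p) (leftmost∈ (pruneAt a (d ∷ p)))) (∈-prune⁻ (d' ∷ p') m)) h₁))

  sameTriangle-inA↝inA : ∀ {a b d p r θ'} → let T = node a b ; θ = (L ∷ d ∷ p , L ∷ r) in
    RedundancyIsTriangular a → Distinct T → Valid a (d ∷ p) → Valid a r → ¬ ((d ∷ p) ≼ r) →
    TopMove T θ' → Redundant T θ θ' → SameTriangle T θ θ'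
  sameTriangle-inA↝inA _ D vq vr nd (a↝b₁ vs') red = SameTriangle-sym (sameTriangle-a↝b₁ D vs' (inA↝inA vq vr nd) (Redundant-sym red))
  sameTriangle-inA↝inA _ D vq vr nd (a↝b₂ vs') red = SameTriangle-sym (sameTriangle-a↝b₂ D vs' (inA↝inA vq vr nd) (Redundant-sym red))
  sameTriangle-inA↝inA _ D vq vr nd (inA↝root vq') red = SameTriangle-sym (sameTriangle-inA↝root D vq' (inA↝inA vq vr nd) (Redundant-sym red))
  sameTriangle-inA↝inA _ D vq vr nd (inA↝b vq' vr') red = SameTriangle-sym (sameTriangle-inA↝b D vq' vr' (inA↝inA vq vr nd) (Redundant-sym red))
  sameTriangle-inA↝inA {a} {_} {_} {_} {r} ih (Dᵃ , _ , Dᵃᵇ) vq vr nd (inA↝inA vq' vr' nd') (θ≢θ' , h , nT) with node-≅⁻ h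
  ... | inj₂ (h₁ , _) = ⊥-elim (≇-by-leaf (∈-snpr⁺ r vq (leftmost∈ a)) (λ m → Dᵃᵇ (leftmost∈ a) m) h₁)
  ... | inj₁ (h₁ , _) with ih Dᵃ (vq , vr , (λ ()) , nd) (vq' , vr' , (λ ()) , nd')
                              ((λ eq → θ≢θ' (cong (liftOp L) eq)) , h₁ , (λ k → nT (node k ≅-refl)))
  ... | (q , c , c') , v , m , m' = (L ∷ q , c , c') , goL v , ∈-map⁺ (liftOp L) m , ∈-map⁺ (liftOp L) m'
  sameTriangle-inA↝inA {node a₁ _} {b} _ (_ , _ , Dᵃᵇ) _ _ _ (b↝a₁ {s = s'} _) (_ , h , _) = contradiction h (node-≇
    (λ (_ , h₂) → ≇-by-leaf (leftmost∈ b) (λ m → Dᵃᵇ (inR m) (leftmost∈ b)) h₂)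
    (λ (_ , h₂) → ≇-by-leaf′ (λ m → Dᵃᵇ (inL (leftmost∈ a₁)) m) (∈-graft⁺ˡ s' (leftmost∈ a₁)) h₂))
  sameTriangle-inA↝inA {node _ a₂} {b} _ (_ , _ , Dᵃᵇ) _ _ _ (b↝a₂ {s = s'} _) (_ , h , _) = contradiction h (node-≇
    (λ (_ , h₂) → ≇-by-leaf′ (λ m → Dᵃᵇ (inR (leftmost∈ a₂)) m) (∈-graft⁺ˡ s' (leftmost∈ a₂)) h₂)
    (λ (_ , h₂) → ≇-by-leaf (leftmost∈ b) (λ m → Dᵃᵇ (inL m) (leftmost∈ b)) h₂))
  sameTriangle-inA↝inA {a} {b} _ (_ , Dᵇ , Dᵃᵇ) _ _ _ (inB↝root {d = d'} {p = p'} vq') (_ , h , _) = contradiction h (node-≇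
    (λ (_ , h₂) → ≇-by-leaf (∈-prune⁻ (d' ∷ p') (leftmost∈ (pruneAt b (d' ∷ p')))) (λ m → sub-prune-disjoint Dᵇ vq' m (leftmost∈ (pruneAt b (d' ∷ p')))) h₂)
    (λ (_ , h₂) → ≇-by-leaf′ (λ m → Dᵃᵇ (leftmost∈ a) m) (inL (leftmost∈ a)) h₂))
  sameTriangle-inA↝inA {a} {_} {_} {_} {r} _ (_ , _ , Dᵃᵇ) vq _ _ (inB↝inB {d = d'} {p = p'} {r = r'} _ _ _) (_ , h , nT) with node-≅⁻ h
  ... | inj₁ (h₁ , _) = ⊥-elim (nT (node h₁ ≅-refl))
  ... | inj₂ (h₁ , _) = ⊥-elim (≇-by-leaf (∈-snpr⁺ r vq (leftmost∈ a)) (λ m → Dᵃᵇ (leftmost∈ a) (∈-snpr⁻ (d' ∷ p' , r') m)) h₁)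
  sameTriangle-inA↝inA {a} {b} _ (_ , Dᵇ , Dᵃᵇ) _ _ _ (inB↝a {d = d'} {p = p'} {r = r'} vq' _) (_ , h , _) = contradiction h (node-≇
    (λ (_ , h₂) → ≇-by-leaf (∈-sub⁻ (d' ∷ p') (leftmost∈ (sub b (d' ∷ p')))) (λ m → sub-prune-disjoint Dᵇ vq' (leftmost∈ (sub b (d' ∷ p'))) m) h₂)
    (λ (_ , h₂) → ≇-by-leaf′ (λ m → Dᵃᵇ (leftmost∈ a) m) (∈-graft⁺ˡ r' (leftmost∈ a)) h₂))

  sameTriangle-left : ∀ {a b e f θ'} → let T = node a b ; θ = (L ∷ e , f) in
    RedundancyIsTriangular a → Distinct T → IsSNPR T θ → IsSNPR T θ' → Redundant T θ θ' → SameTriangle T θ θ'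
  sameTriangle-left ih D s s' red@(_ , h , nT) with topMove s | topMove s'
  ... | inj₁ k | _ = ⊥-elim (nT k)
  ... | inj₂ _ | inj₁ k' = ⊥-elim (nT (≅-trans h k'))
  ... | inj₂ (a↝b₁ vs) | inj₂ m' = sameTriangle-a↝b₁ D vs m' red
  ... | inj₂ (a↝b₂ vs) | inj₂ m' = sameTriangle-a↝b₂ D vs m' red
  ... | inj₂ (inA↝root vq) | inj₂ m' = sameTriangle-inA↝root D vq m' red
  ... | inj₂ (inA↝inA vq vr nd) | inj₂ m' = sameTriangle-inA↝inA ih D vq vr nd m' red
  ... | inj₂ (inA↝b vq vr) | inj₂ m' = sameTriangle-inA↝b D vq vr m' red

  redundancyIsTriangular : ∀ T → RedundancyIsTriangular T
  redundancyIsTriangular _ _ {[] , _} (_ , _ , e≢[] , _) = ⊥-elim (e≢[] refl)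
  redundancyIsTriangular (leaf _) _ {_ ∷ _ , _} (() , _)
  redundancyIsTriangular (node a b) D {L ∷ _ , _} = sameTriangle-left (redundancyIsTriangular a) D
  redundancyIsTriangular (node a b) D {R ∷ _ , _} s s' red =
    sameTriangle-mirror⁻ (sameTriangle-left ih (mirror-distinct (node a b) D) (mirror-snpr s) (mirror-snpr s') (mirror-redundant red))
    where
      ih : RedundancyIsTriangular (mirror b)
      ih = redundancyIsTriangular-mirror⁻ (subst RedundancyIsTriangular (sym (mirror-involutive b)) (redundancyIsTriangular b))

module _ {A : Set} {T : BT A} (D : Distinct T) where

  redundant⇒nni : ∀ {θ θ'} → IsSNPR T θ → IsSNPR T θ' → θ ≢ θ' →
    applySNPR T θ ≅ applySNPR T θ' → ¬ (applySNPR T θ ≅ T) →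
    ∃[ σ ] (IsNNI T σ × applyNNI T σ ≅ applySNPR T θ)
  redundant⇒nni s s' θ≢θ' h nT with redundancyIsTriangular T D s s' (θ≢θ' , h , nT)
  ... | σ , v , m , _ = σ , v , ≅-sym (lookup (triangle-≅ σ v) m)

  maximalRedundantSet-length : (S : List Op) → Unique S → All (IsSNPR T) S → 2 ≤ length S →
    All (λ θ → ¬ (applySNPR T θ ≅ T)) S →
    (∀ {θ θ'} → θ ∈ S → θ' ∈ S → applySNPR T θ ≅ applySNPR T θ') →
    ((θ : Op) → IsSNPR T θ → All (λ θ' → applySNPR T θ ≅ applySNPR T θ') S → θ ∈ S) →
    length S ≡ 3
  maximalRedundantSet-length [] _ _ () _ _ _
  maximalRedundantSet-length (_ ∷ []) _ _ (s≤s ()) _ _ _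
  maximalRedundantSet-length S@(θ₀ ∷ _ ∷ _) uS@(θ₀∉ ∷ _) snpr _ nontrivial same maximal =
    let σ , v , m₀ , _ = redundancyIsTriangular T D (lookup snpr (here refl)) (lookup snpr (there (here refl)))
                           (redundant (there (here refl)) (lookup θ₀∉ (here refl)))
    in unique-same-members⇒same-length uS (triangle-unique σ) (S⊆triangle σ m₀) (triangle⊆S σ v m₀)
    where
      redundant : ∀ {θ} → θ ∈ S → θ₀ ≢ θ → Redundant T θ₀ θ
      redundant m θ₀≢θ = θ₀≢θ , same (here refl) m , lookup nontrivial (here refl)

      S⊆triangle : ∀ σ → θ₀ ∈ triangle σ → ∀ {θ} → θ ∈ S → θ ∈ triangle σ
      S⊆triangle σ m₀ (here refl) = m₀
      S⊆triangle σ m₀ {θ} (there m) =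
        let σ' , _ , m₀' , m' = redundancyIsTriangular T D (lookup snpr (here refl)) (lookup snpr (there m))
                                  (redundant (there m) (lookup θ₀∉ m))
        in subst (θ ∈_) (triangle-≡ σ' σ m₀' m₀) m'

      triangle⊆S : ∀ σ → IsNNI T σ → θ₀ ∈ triangle σ → ∀ {θ} → θ ∈ triangle σ → θ ∈ S
      triangle⊆S σ v m₀ m = maximal _ (lookup (triangle-snpr σ v) m) (All.tabulate λ m' →
        ≅-trans (lookup (triangle-≅ σ v) m) (≅-trans (≅-sym (lookup (triangle-≅ σ v) m₀)) (same (here refl) m')))

lemma5 : (n : ℕ) → 2 ≤ n → (T : BT (Fin n)) → IsPhylo T →
    ((θ θ' : Op) → IsSNPR T θ → IsSNPR T θ' → θ ≢ θ' →
      applySNPR T θ ≅ applySNPR T θ' → ¬ (applySNPR T θ ≅ T) →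
      ∃[ σ ] (IsNNI T σ × applyNNI T σ ≅ applySNPR T θ))
    ×
    ((S : List Op) → Unique S → All (IsSNPR T) S → 2 ≤ length S →
      All (λ θ → ¬ (applySNPR T θ ≅ T)) S →
      (∀ {θ θ'} → θ ∈ S → θ' ∈ S → applySNPR T θ ≅ applySNPR T θ') →
      ((θ : Op) → IsSNPR T θ → All (λ θ' → applySNPR T θ ≅ applySNPR T θ') S → θ ∈ S) →
      length S ≡ 3)
lemma5 n _ T ph = (λ _ _ → redundant⇒nni D) , maximalRedundantSet-length D
  where
    D : Distinct T
    D = phylo⇒distinct T ph
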